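{- Let $n\ge3$ and let $C$ be a chamber of $|\mathrm{NCP}_n|$. Then $C$ is a universal chamber if and only if every codimension-one face of $C$ is contained in exactly three chambers of $|\mathrm{NCP}_n|$.
   Context: $\mathrm{NCP}_n$ is the lattice of non-crossing partitions of $\{1,\ldots,n\}$ (no $a<b<c<d$ with $a,c$ in one block and $b,d$ in another), ordered by refinement. $|\mathrm{NCP}_n|$ is the simplicial complex whose vertices are the non-crossing partitions other than the finest and the coarsest one and whose simplices are chains; chambers are the maximal simplices (chains with one partition of each rank $1,\ldots,n-2$, rank $=n-\#\text{blocks}$). A block is non-trivial if it has at least two elements. A non-crossing partition is universal if it has exactly one non-trivial block and that block consists of circularly consecutive elements of $\{1,\ldots,n\}$ (consecutive with respect to the cyclic order $1,2,\ldots,n,1$). A chamber is universal if all its vertices are universal partitions. -}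

module Defs where

open import Data.Nat using (ℕ; zero; suc; _+_; _∸_; _≤_; _<_)
open import Data.Fin using (Fin; toℕ; _≟_)
open import Data.Vec using (Vec; lookup)
open import Data.List using (List; length; filter; allFin)
open import Data.Product using (Σ; ∃; ∃-syntax; _×_; _,_)
open import Data.Sum using (_⊎_)
open import Relation.Nullary using (¬_)
open import Relation.Binary.PropositionalEquality using (_≡_; _≢_)

-- A set partition of {0,…,n-1} (standing for {1,…,n}) is encoded canonically by
-- the vector assigning to each element the least element of its block.
Part : ℕ → Set
Part n = Vec (Fin n) n

IsPartition : {n : ℕ} → Part n → Set
IsPartition {n} v = (i : Fin n) → (toℕ (lookup v i) ≤ toℕ i) × (lookup v (lookup v i) ≡ lookup v i)

SameBlock : {n : ℕ} → Part n → Fin n → Fin n → Set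
SameBlock v i j = lookup v i ≡ lookup v j

IsNonCrossing : {n : ℕ} → Part n → Set
IsNonCrossing {n} v = (a b c d : Fin n) → toℕ a < toℕ b → toℕ b < toℕ c → toℕ c < toℕ d →
  SameBlock v a c → SameBlock v b d → SameBlock v a b

IsNCP : {n : ℕ} → Part n → Set
IsNCP v = IsPartition v × IsNonCrossing v

Refines : {n : ℕ} → Part n → Part n → Set
Refines {n} v w = (i j : Fin n) → SameBlock v i j → SameBlock w i j

-- number of blocks = number of block representatives (fixed points)
numBlocks : {n : ℕ} → Part n → ℕ
numBlocks {n} v = length (filter (λ i → lookup v i ≟ i) (allFin n))

rank : {n : ℕ} → Part n → ℕ
rank {n} v = n ∸ numBlocks v

-- Chambers of |NCP_n|: a chamber is a chain with exactly one non-crossing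
-- partition of each rank 1,…,n-2; it is stored as the vector of its vertices
-- listed by rank (entry k has rank k+1), which determines the chamber uniquely.
Chain : ℕ → Set
Chain n = Vec (Part n) (n ∸ 2)

IsChamber : {n : ℕ} → Chain n → Set
IsChamber {n} C =
  ((k : Fin (n ∸ 2)) → IsNCP (lookup C k)) ×
  ((k : Fin (n ∸ 2)) → rank (lookup C k) ≡ suc (toℕ k)) ×
  ((k l : Fin (n ∸ 2)) → toℕ k < toℕ l → Refines (lookup C k) (lookup C l))

NonTrivialBlockAt : {n : ℕ} → Part n → Fin n → Set
NonTrivialBlockAt v i = ∃[ j ] (j ≢ i × SameBlock v i j)

-- the block of i is circularly consecutive: it equals {s, s+1, …, s+l-1} (mod n)
-- for some start s and some length l ≤ n
CircConsecBlockAt : {n : ℕ} → Part n → Fin n → Set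
CircConsecBlockAt {n} v i = Σ (Fin n) λ s → Σ ℕ λ l → (l ≤ n) ×
  ((j : Fin n) →
    (SameBlock v i j → ((toℕ s ≤ toℕ j × toℕ j < toℕ s + l) ⊎ (toℕ j + n < toℕ s + l))) ×
    (((toℕ s ≤ toℕ j × toℕ j < toℕ s + l) ⊎ (toℕ j + n < toℕ s + l)) → SameBlock v i j))

IsUniversal : {n : ℕ} → Part n → Set
IsUniversal {n} v = Σ (Fin n) λ i →
  NonTrivialBlockAt v i ×
  ((j k : Fin n) → NonTrivialBlockAt v j → NonTrivialBlockAt v k → SameBlock v j k) ×
  CircConsecBlockAt v i

IsUniversalChamber : {n : ℕ} → Chain n → Set
IsUniversalChamber {n} C = (k : Fin (n ∸ 2)) → IsUniversal (lookup C k)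

-- D contains the codimension-one face of C obtained by deleting the vertex of C
-- of rank j+1 (vertices of D and C have the same rank exactly at the same index)
ContainsFace : {n : ℕ} → Chain n → Fin (n ∸ 2) → Chain n → Set
ContainsFace {n} C j D = (k : Fin (n ∸ 2)) → k ≢ j → lookup D k ≡ lookup C k

InExactlyThreeChambers : {n : ℕ} → Chain n → Fin (n ∸ 2) → Set
InExactlyThreeChambers {n} C j = Σ (Chain n) λ D₁ → Σ (Chain n) λ D₂ → Σ (Chain n) λ D₃ →
  (IsChamber D₁ × ContainsFace C j D₁) ×
  (IsChamber D₂ × ContainsFace C j D₂) ×
  (IsChamber D₃ × ContainsFace C j D₃) ×
  (D₁ ≢ D₂ × D₁ ≢ D₃ × D₂ ≢ D₃) ×
  ((D : Chain n) → IsChamber D → ContainsFace C j D → (D ≡ D₁ ⊎ D ≡ D₂ ⊎ D ≡ D₃))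

module Submission where

-- A chamber C₁ < … < C_{n-2} is
-- extended by the finest partition X₀ and the coarsest X_{n-1}; the chambers
-- containing the face C ∖ {C_{j+1}} correspond to the non-crossing partitions
-- ("middles") of rank j+1 between X_j and X_{j+2} (module Extended).  In such a
-- rank-two interval x < z exactly two representatives r₁ < r₂ of x are lost in
-- z, and a middle y is determined by (y r₁ , y r₂), which follows one of three
-- patterns (Tag): r₂ joins z r₂, r₁ joins z r₁, or r₂ joins r₁.  Hence a face
-- lies in three chambers iff each pattern is realised (RankTwo).
--   (⇒) If every block of x is an arc and z has a single non-trivial block, the
--   three merges of two x-blocks inside z are non-crossing (MergeInto), so every
--   face of a universal chamber lies in three chambers (UniversalChamber).
--   (⇐) The pattern "r₂ joins r₁" forces z r₁ = z r₂, so upward from X₀ every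
--   vertex has a single non-trivial block.  Downward from X_{n-2}, whose big
--   block is the complement of a point, that block is an arc: deleting a point
--   from an arc leaves an arc unless the point lies strictly inside, and then a
--   third middle would contain a crossing (ArcMinusPoint, OnRepresentatives,
--   ThreeChambersEverywhere).

open import Defs
open import Data.Nat using (ℕ; zero; suc; pred; _+_; _∸_; _≤_; _<_; z≤n; s≤s; s≤s⁻¹; >-nonZero; _<?_; _≤?_)
  renaming (_≟_ to _≟ℕ_)
open import Data.Nat.Properties hiding (_≟_)
open import Data.Fin using (Fin; toℕ; fromℕ<; _≟_) renaming (zero to fzero; suc to fsuc)
open import Data.Fin.Properties using (toℕ-injective; toℕ<n; toℕ-fromℕ<; ¬∀⟶∃¬) renaming (suc-injective to fsuc-injective)
open import Data.Vec using (Vec; lookup; tabulate; replicate; []; _∷_; _[_]≔_)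
open import Data.Vec.Properties
  using (lookup∘tabulate; tabulate∘lookup; tabulate-cong; lookup-replicate; lookup∘update; lookup∘update′)
open import Data.List using (length; filter)
import Data.List as List
open import Data.Product using (Σ; ∃-syntax; _×_; _,_; proj₁; proj₂)
open import Data.Sum using (_⊎_; inj₁; inj₂; [_,_]′) renaming (swap to ⊎-swap)
open import Data.Empty using (⊥; ⊥-elim)
open import Relation.Nullary using (¬_; Dec; yes; no)
open import Relation.Binary.PropositionalEquality
open import Relation.Binary.Definitions using (tri<; tri≈; tri>)
open import Function.Bundles using (_⇔_; mk⇔)

sumFin : {n : ℕ} → (Fin n → ℕ) → ℕ
sumFin {zero} f = 0
sumFin {suc n} f = f fzero + sumFin (λ i → f (fsuc i))

indicator : {P : Set} → Dec P → ℕ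
indicator (yes _) = 1
indicator (no _) = 0

indicator≤1 : {P : Set} (d : Dec P) → indicator d ≤ 1
indicator≤1 (yes _) = s≤s z≤n
indicator≤1 (no _) = z≤n

length-filter-tabulate : {n : ℕ} {A : Set} {P : A → Set} (P? : (a : A) → Dec (P a)) (f : Fin n → A) →
  length (filter P? (List.tabulate f)) ≡ sumFin (λ i → indicator (P? (f i)))
length-filter-tabulate {zero} P? f = refl
length-filter-tabulate {suc n} P? f with P? (f fzero)
... | yes _ = cong suc (length-filter-tabulate P? (λ i → f (fsuc i)))
... | no _ = length-filter-tabulate P? (λ i → f (fsuc i))

sumFin-cong : {n : ℕ} {f g : Fin n → ℕ} → (∀ i → f i ≡ g i) → sumFin f ≡ sumFin g
sumFin-cong {zero} e = refl
sumFin-cong {suc n} e = cong₂ _+_ (e fzero) (sumFin-cong (λ i → e (fsuc i)))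

sumFin-+ : {n : ℕ} (f g : Fin n → ℕ) → sumFin (λ i → f i + g i) ≡ sumFin f + sumFin g
sumFin-+ {zero} f g = refl
sumFin-+ {suc n} f g = begin
  f fzero + g fzero + sumFin (λ i → f (fsuc i) + g (fsuc i))
    ≡⟨ cong (f fzero + g fzero +_) (sumFin-+ (λ i → f (fsuc i)) (λ i → g (fsuc i))) ⟩
  f fzero + g fzero + (F + G)   ≡⟨ +-assoc (f fzero) (g fzero) (F + G) ⟩
  f fzero + (g fzero + (F + G)) ≡⟨ cong (f fzero +_) (+-comm (g fzero) (F + G)) ⟩
  f fzero + ((F + G) + g fzero) ≡⟨ cong (f fzero +_) (+-assoc F G (g fzero)) ⟩
  f fzero + (F + (G + g fzero)) ≡⟨ cong (λ t → f fzero + (F + t)) (+-comm G (g fzero)) ⟩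
  f fzero + (F + (g fzero + G)) ≡⟨ sym (+-assoc (f fzero) F (g fzero + G)) ⟩
  f fzero + F + (g fzero + G)   ∎
  where
  open ≡-Reasoning
  F = sumFin (λ i → f (fsuc i))
  G = sumFin (λ i → g (fsuc i))

sumFin-zero : {n : ℕ} (f : Fin n → ℕ) → (∀ i → f i ≡ 0) → sumFin f ≡ 0
sumFin-zero {zero} f e = refl
sumFin-zero {suc n} f e rewrite e fzero = sumFin-zero (λ i → f (fsuc i)) (λ i → e (fsuc i))

sumFin-zero⁻¹ : {n : ℕ} (f : Fin n → ℕ) → sumFin f ≡ 0 → ∀ i → f i ≡ 0
sumFin-zero⁻¹ {suc n} f e fzero = m+n≡0⇒m≡0 (f fzero) e
sumFin-zero⁻¹ {suc n} f e (fsuc i) = sumFin-zero⁻¹ (λ i → f (fsuc i)) (m+n≡0⇒n≡0 (f fzero) e) i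

sumFin-ones : {n : ℕ} (f : Fin n → ℕ) → (∀ i → f i ≡ 1) → sumFin f ≡ n
sumFin-ones {zero} f e = refl
sumFin-ones {suc n} f e rewrite e fzero = cong suc (sumFin-ones (λ i → f (fsuc i)) (λ i → e (fsuc i)))

sumFin-mono : {n : ℕ} (f g : Fin n → ℕ) → (∀ i → f i ≤ g i) → sumFin f ≤ sumFin g
sumFin-mono {zero} f g e = z≤n
sumFin-mono {suc n} f g e =
  +-mono-≤ (e fzero) (sumFin-mono (λ i → f (fsuc i)) (λ i → g (fsuc i)) (λ i → e (fsuc i)))

sumFin≤n : {n : ℕ} (f : Fin n → ℕ) → (∀ i → f i ≤ 1) → sumFin f ≤ n
sumFin≤n {n} f e = subst (sumFin f ≤_) (sumFin-ones {n} (λ _ → 1) (λ _ → refl)) (sumFin-mono f (λ _ → 1) e)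

sumFin-pos : {n : ℕ} (f : Fin n → ℕ) → 0 < sumFin f → ∃[ i ] (0 < f i)
sumFin-pos {suc n} f p with f fzero in eq
... | suc k = fzero , subst (0 <_) (sym eq) (s≤s z≤n)
... | zero with sumFin-pos (λ i → f (fsuc i)) p
... | i , q = fsuc i , q

dropAt : {n : ℕ} → Fin n → (Fin n → ℕ) → Fin n → ℕ
dropAt a f i with i ≟ a
... | yes _ = 0
... | no _ = f i

dropAt-≢ : {n : ℕ} (a : Fin n) (f : Fin n → ℕ) (i : Fin n) → i ≢ a → dropAt a f i ≡ f i
dropAt-≢ a f i ne with i ≟ a
... | yes e = ⊥-elim (ne e)
... | no _ = refl

dropAt-≡ : {n : ℕ} (a : Fin n) (f : Fin n → ℕ) → dropAt a f a ≡ 0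
dropAt-≡ a f with a ≟ a
... | yes _ = refl
... | no ne = ⊥-elim (ne refl)

dropAt-≤1 : {n : ℕ} (a : Fin n) (f : Fin n → ℕ) → (∀ i → f i ≤ 1) → ∀ i → dropAt a f i ≤ 1
dropAt-≤1 a f le i with i ≟ a
... | yes _ = z≤n
... | no _ = le i

sumFin-dropAt : {n : ℕ} (a : Fin n) (f : Fin n → ℕ) → sumFin f ≡ f a + sumFin (dropAt a f)
sumFin-dropAt {suc n} fzero f = cong (f fzero +_) (sumFin-cong rest)
  where
  rest : ∀ i → f (fsuc i) ≡ dropAt fzero f (fsuc i)
  rest i = sym (dropAt-≢ fzero f (fsuc i) (λ ()))
sumFin-dropAt {suc n} (fsuc a) f = begin
  f fzero + F                             ≡⟨ cong (f fzero +_) (sumFin-dropAt a (λ i → f (fsuc i))) ⟩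
  f fzero + (f (fsuc a) + D)              ≡⟨ sym (+-assoc (f fzero) (f (fsuc a)) D) ⟩
  f fzero + f (fsuc a) + D                ≡⟨ cong (_+ D) (+-comm (f fzero) (f (fsuc a))) ⟩
  f (fsuc a) + f fzero + D                ≡⟨ +-assoc (f (fsuc a)) (f fzero) D ⟩
  f (fsuc a) + (f fzero + D)              ≡⟨ cong (f (fsuc a) +_) (cong₂ _+_ head (sumFin-cong tail)) ⟩
  f (fsuc a) + sumFin (dropAt (fsuc a) f) ∎
  where
  open ≡-Reasoning
  F = sumFin (λ i → f (fsuc i))
  D = sumFin (dropAt a (λ i → f (fsuc i)))
  head : f fzero ≡ dropAt (fsuc a) f fzero
  head = sym (dropAt-≢ (fsuc a) f fzero (λ ()))
  tail : ∀ i → dropAt a (λ j → f (fsuc j)) i ≡ dropAt (fsuc a) f (fsuc i)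
  tail i with i ≟ a | fsuc i ≟ fsuc a
  ... | yes _ | yes _ = refl
  ... | no _ | no _ = refl
  ... | yes refl | no ne = ⊥-elim (ne refl)
  ... | no ne | yes e = ⊥-elim (ne (fsuc-injective e))

singleSupport : {n : ℕ} (h : Fin n → ℕ) → (∀ i → h i ≤ 1) → sumFin h ≡ 1 →
  Σ (Fin n) λ r → (0 < h r) × (∀ i → 0 < h i → i ≡ r)
singleSupport h le e with sumFin-pos h (subst (0 <_) (sym e) (s≤s z≤n))
... | r , p = r , p , unique
  where
  hr≡1 : h r ≡ 1
  hr≡1 = ≤-antisym (le r) p
  rest≡0 : ∀ i → dropAt r h i ≡ 0
  rest≡0 = sumFin-zero⁻¹ (dropAt r h)
    (+-cancelˡ-≡ 1 _ _ (trans (cong (_+ sumFin (dropAt r h)) (sym hr≡1)) (trans (sym (sumFin-dropAt r h)) e)))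
  unique : ∀ i → 0 < h i → i ≡ r
  unique i q with i ≟ r
  ... | yes eq = eq
  ... | no ne = ⊥-elim (<-irrefl (sym (trans (sym (dropAt-≢ r h i ne)) (rest≡0 i))) q)

twoPointSupport : {n : ℕ} (h : Fin n → ℕ) → (∀ i → h i ≤ 1) → sumFin h ≡ 2 →
  Σ (Fin n) λ r₁ → Σ (Fin n) λ r₂ → (0 < h r₁) × (0 < h r₂) × (r₁ ≢ r₂) ×
    (∀ i → 0 < h i → i ≡ r₁ ⊎ i ≡ r₂)
twoPointSupport h le e with sumFin-pos h (subst (0 <_) (sym e) (s≤s z≤n))
... | r₁ , p₁ = r₁ , r₂ , p₁ , p₂ , r₁≢r₂ , cover
  where
  rest = dropAt r₁ h
  restSum : sumFin rest ≡ 1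
  restSum = +-cancelˡ-≡ 1 _ _
    (trans (cong (_+ sumFin rest) (sym (≤-antisym (le r₁) p₁))) (trans (sym (sumFin-dropAt r₁ h)) e))
  other = singleSupport rest (dropAt-≤1 r₁ h le) restSum
  r₂ = proj₁ other
  r₁≢r₂ : r₁ ≢ r₂
  r₁≢r₂ eq = <-irrefl (sym (trans (cong rest (sym eq)) (dropAt-≡ r₁ h))) (proj₁ (proj₂ other))
  p₂ : 0 < h r₂
  p₂ = subst (0 <_) (dropAt-≢ r₁ h r₂ (λ q → r₁≢r₂ (sym q))) (proj₁ (proj₂ other))
  cover : ∀ i → 0 < h i → i ≡ r₁ ⊎ i ≡ r₂
  cover i q with i ≟ r₁
  ... | yes eq = inj₁ eq
  ... | no ne = inj₂ (proj₂ (proj₂ other) i (subst (0 <_) (sym (dropAt-≢ r₁ h i ne)) q))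

sumFin-twoPoints : {n : ℕ} (h : Fin n → ℕ) (a b : Fin n) → a ≢ b → (∀ i → 0 < h i → i ≡ a ⊎ i ≡ b) →
  sumFin h ≡ h a + h b
sumFin-twoPoints h a b ne support = begin
  sumFin h                                          ≡⟨ sumFin-dropAt a h ⟩
  h a + sumFin (dropAt a h)                         ≡⟨ cong (h a +_) (sumFin-dropAt b (dropAt a h)) ⟩
  h a + (dropAt a h b + sumFin (dropAt b (dropAt a h)))
    ≡⟨ cong (h a +_) (cong₂ _+_ (dropAt-≢ a h b (λ e → ne (sym e))) (sumFin-zero _ vanish)) ⟩
  h a + (h b + 0)                                   ≡⟨ cong (h a +_) (+-identityʳ (h b)) ⟩
  h a + h b                                         ∎
  where
  open ≡-Reasoning
  vanish : ∀ i → dropAt b (dropAt a h) i ≡ 0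
  vanish i with i ≟ b
  ... | yes _ = refl
  ... | no nb with i ≟ a
  ... | yes _ = refl
  ... | no na with h i in eq
  ... | zero = refl
  ... | suc _ = ⊥-elim ([ na , nb ]′ (support i (subst (0 <_) (sym eq) (s≤s z≤n))))

vec-ext : {m : ℕ} {A : Set} (u v : Vec A m) → (∀ i → lookup u i ≡ lookup v i) → u ≡ v
vec-ext u v e = trans (sym (tabulate∘lookup u)) (trans (tabulate-cong e) (tabulate∘lookup v))

_!_ : {n : ℕ} → Part n → Fin n → Fin n
v ! i = lookup v i

isRep : {n : ℕ} → Part n → Fin n → ℕ
isRep v i = indicator (v ! i ≟ i)

lostRep : {n : ℕ} → Part n → Part n → Fin n → ℕ
lostRep x z i = isRep x i ∸ isRep z i

module _ {n : ℕ} where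
  numBlocks≡reps : (v : Part n) → numBlocks v ≡ sumFin (isRep v)
  numBlocks≡reps v = length-filter-tabulate (λ i → lookup v i ≟ i) (λ i → i)

  rep≤ : (v : Part n) → IsPartition v → ∀ i → toℕ (v ! i) ≤ toℕ i
  rep≤ v p i = proj₁ (p i)

  rep-idem : (v : Part n) → IsPartition v → ∀ i → v ! (v ! i) ≡ v ! i
  rep-idem v p i = proj₂ (p i)

  refines-rep : (x y : Part n) → IsPartition x → Refines x y → ∀ i → y ! i ≡ y ! (x ! i)
  refines-rep x y px r i = r i (x ! i) (sym (rep-idem x px i))

  rep-of-coarser : (x y : Part n) → IsPartition x → IsPartition y → Refines x y →
    ∀ i → y ! i ≡ i → x ! i ≡ i
  rep-of-coarser x y px py r i e = toℕ-injective (≤-antisym (rep≤ x px i) i≤xi)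
    where
    i≤xi : toℕ i ≤ toℕ (x ! i)
    i≤xi = subst (λ w → toℕ w ≤ toℕ (x ! i)) (trans (sym (refines-rep x y px r i)) e) (rep≤ y py (x ! i))

  refines-trans : (x y z : Part n) → Refines x y → Refines y z → Refines x z
  refines-trans x y z r s i j e = s i j (r i j e)

  isRep-yes : (v : Part n) (i : Fin n) → v ! i ≡ i → isRep v i ≡ 1
  isRep-yes v i e with v ! i ≟ i
  ... | yes _ = refl
  ... | no ne = ⊥-elim (ne e)

  isRep-no : (v : Part n) (i : Fin n) → v ! i ≢ i → isRep v i ≡ 0
  isRep-no v i e with v ! i ≟ i
  ... | yes q = ⊥-elim (e q)
  ... | no ne = refl

  isRep-pos : (v : Part n) (i : Fin n) → 0 < isRep v i → v ! i ≡ i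
  isRep-pos v i p with v ! i ≟ i
  ... | yes q = q
  ... | no ne = ⊥-elim (<-irrefl refl p)

  reps+rank : (v : Part n) (k : ℕ) → rank v ≡ k → sumFin (isRep v) + k ≡ n
  reps+rank v k e = begin
    sumFin (isRep v) + k      ≡⟨ cong (sumFin (isRep v) +_) (sym e') ⟩
    sumFin (isRep v) + (n ∸ sumFin (isRep v)) ≡⟨ m+[n∸m]≡n reps≤n ⟩
    n ∎
    where
    open ≡-Reasoning
    reps≤n : sumFin (isRep v) ≤ n
    reps≤n = sumFin≤n (isRep v) (λ i → indicator≤1 (v ! i ≟ i))
    e' : n ∸ sumFin (isRep v) ≡ k
    e' = trans (cong (n ∸_) (sym (numBlocks≡reps v))) e

  reps-gap : (x z : Part n) (d k : ℕ) → rank x ≡ k → rank z ≡ d + k →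
    sumFin (isRep x) ≡ sumFin (isRep z) + d
  reps-gap x z d k rx rz = +-cancelʳ-≡ k _ _
    (trans (reps+rank x k rx) (trans (sym (reps+rank z (d + k) rz)) (sym (+-assoc _ d k))))

  rank-from-reps : (y z : Part n) (d k : ℕ) → sumFin (isRep y) ≡ sumFin (isRep z) + d → rank z ≡ d + k →
    rank y ≡ k
  rank-from-reps y z d k e rz = begin
    n ∸ numBlocks y                     ≡⟨ cong (n ∸_) (trans (numBlocks≡reps y) e) ⟩
    n ∸ (sumFin (isRep z) + d)          ≡⟨ cong (_∸ (sumFin (isRep z) + d)) (sym total) ⟩
    (sumFin (isRep z) + d) + k ∸ (sumFin (isRep z) + d) ≡⟨ m+n∸m≡n (sumFin (isRep z) + d) k ⟩
    k ∎
    where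
    open ≡-Reasoning
    total : sumFin (isRep z) + d + k ≡ n
    total = trans (+-assoc (sumFin (isRep z)) d k) (reps+rank z (d + k) rz)

  lostRep-split : (x z : Part n) → IsPartition x → IsPartition z → Refines x z →
    ∀ i → isRep x i ≡ isRep z i + lostRep x z i
  lostRep-split x z px pz r i with z ! i ≟ i | x ! i ≟ i
  ... | yes e | yes _ = refl
  ... | yes e | no ne = ⊥-elim (ne (rep-of-coarser x z px pz r i e))
  ... | no _ | yes _ = refl
  ... | no _ | no _ = refl

  reps-refine : (x z : Part n) → IsPartition x → IsPartition z → Refines x z →
    sumFin (isRep x) ≡ sumFin (isRep z) + sumFin (lostRep x z)
  reps-refine x z px pz r = trans (sumFin-cong (lostRep-split x z px pz r)) (sumFin-+ (isRep z) (lostRep x z))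

  lostRep-count : (x z : Part n) (d k : ℕ) → IsPartition x → IsPartition z → Refines x z →
    rank x ≡ k → rank z ≡ d + k → sumFin (lostRep x z) ≡ d
  lostRep-count x z d k px pz r rx rz =
    +-cancelˡ-≡ (sumFin (isRep z)) _ _ (trans (sym (reps-refine x z px pz r)) (reps-gap x z d k rx rz))

  lostRep-pos : (x z : Part n) (i : Fin n) → 0 < lostRep x z i → x ! i ≡ i × z ! i ≢ i
  lostRep-pos x z i p with z ! i ≟ i | x ! i ≟ i
  ... | yes e | yes _ = ⊥-elim (<-irrefl refl p)
  ... | yes e | no _ = ⊥-elim (<-irrefl refl p)
  ... | no ne | yes e = e , ne
  ... | no _ | no _ = ⊥-elim (<-irrefl refl p)

  lostRep-pos⁻¹ : (x z : Part n) (i : Fin n) → x ! i ≡ i → z ! i ≢ i → 0 < lostRep x z i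
  lostRep-pos⁻¹ x z i e ne rewrite isRep-yes x i e | isRep-no z i ne = s≤s z≤n

  lostRep≤1 : (x z : Part n) (i : Fin n) → lostRep x z i ≤ 1
  lostRep≤1 x z i = ≤-trans (m∸n≤m (isRep x i) (isRep z i)) (indicator≤1 (x ! i ≟ i))

Middle : {n : ℕ} → Part n → Part n → ℕ → Part n → Set
Middle x z k y = IsNCP y × rank y ≡ k × Refines x y × Refines y z

ThreeMiddles : {n : ℕ} → Part n → Part n → ℕ → Set
ThreeMiddles {n} x z k = Σ (Part n) λ y₁ → Σ (Part n) λ y₂ → Σ (Part n) λ y₃ →
  Middle x z k y₁ × Middle x z k y₂ × Middle x z k y₃ × (y₁ ≢ y₂ × y₁ ≢ y₃ × y₂ ≢ y₃) ×
  ((y : Part n) → Middle x z k y → y ≡ y₁ ⊎ y ≡ y₂ ⊎ y ≡ y₃)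

-- The three ways of merging two of the lost representatives' blocks.
data Tag : Set where
  joins₂ joins₁ joins₁₂ : Tag

_≟ᵗ_ : (s t : Tag) → Dec (s ≡ t)
joins₂ ≟ᵗ joins₂ = yes refl
joins₂ ≟ᵗ joins₁ = no λ ()
joins₂ ≟ᵗ joins₁₂ = no λ ()
joins₁ ≟ᵗ joins₂ = no λ ()
joins₁ ≟ᵗ joins₁ = yes refl
joins₁ ≟ᵗ joins₁₂ = no λ ()
joins₁₂ ≟ᵗ joins₂ = no λ ()
joins₁₂ ≟ᵗ joins₁ = no λ ()
joins₁₂ ≟ᵗ joins₁₂ = yes refl

otherTags : Tag → Tag × Tag
otherTags joins₂ = joins₁ , joins₁₂
otherTags joins₁ = joins₂ , joins₁₂
otherTags joins₁₂ = joins₂ , joins₁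

otherTags-cover : ∀ t u → u ≢ t → u ≡ proj₁ (otherTags t) ⊎ u ≡ proj₂ (otherTags t)
otherTags-cover joins₂ joins₂ ne = ⊥-elim (ne refl)
otherTags-cover joins₂ joins₁ _ = inj₁ refl
otherTags-cover joins₂ joins₁₂ _ = inj₂ refl
otherTags-cover joins₁ joins₂ _ = inj₁ refl
otherTags-cover joins₁ joins₁ ne = ⊥-elim (ne refl)
otherTags-cover joins₁ joins₁₂ _ = inj₂ refl
otherTags-cover joins₁₂ joins₂ _ = inj₁ refl
otherTags-cover joins₁₂ joins₁ _ = inj₂ refl
otherTags-cover joins₁₂ joins₁₂ ne = ⊥-elim (ne refl)

-- Three pairwise distinct tags exhaust Tag: otherwise all three would lie
-- among the two tags other than the missing one.
tags-exhaust : {t₁ t₂ t₃ : Tag} → t₁ ≢ t₂ → t₁ ≢ t₃ → t₂ ≢ t₃ → ∀ t → t ≡ t₁ ⊎ t ≡ t₂ ⊎ t ≡ t₃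
tags-exhaust {t₁} {t₂} {t₃} d₁₂ d₁₃ d₂₃ t with t ≟ᵗ t₁ | t ≟ᵗ t₂ | t ≟ᵗ t₃
... | yes e | _ | _ = inj₁ e
... | no _ | yes e | _ = inj₂ (inj₁ e)
... | no _ | no _ | yes e = inj₂ (inj₂ e)
... | no n₁ | no n₂ | no n₃ =
  ⊥-elim (pigeon (otherTags-cover t t₁ (≢-sym n₁)) (otherTags-cover t t₂ (≢-sym n₂)) (otherTags-cover t t₃ (≢-sym n₃)))
  where
  pigeon : {a b : Tag} → t₁ ≡ a ⊎ t₁ ≡ b → t₂ ≡ a ⊎ t₂ ≡ b → t₃ ≡ a ⊎ t₃ ≡ b → ⊥
  pigeon (inj₁ p) (inj₁ q) _ = d₁₂ (trans p (sym q))
  pigeon (inj₂ p) (inj₂ q) _ = d₁₂ (trans p (sym q))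
  pigeon (inj₁ p) (inj₂ q) (inj₁ r) = d₁₃ (trans p (sym r))
  pigeon (inj₁ p) (inj₂ q) (inj₂ r) = d₂₃ (trans q (sym r))
  pigeon (inj₂ p) (inj₁ q) (inj₁ r) = d₂₃ (trans q (sym r))
  pigeon (inj₂ p) (inj₁ q) (inj₂ r) = d₁₃ (trans p (sym r))

module _ {n : ℕ} where
  record LostPair (x z : Part n) : Set where
    field
      r₁ r₂ : Fin n
      r₁<r₂ : toℕ r₁ < toℕ r₂
      x-r₁ : x ! r₁ ≡ r₁
      x-r₂ : x ! r₂ ≡ r₂
      z-r₁ : z ! r₁ ≢ r₁
      z-r₂ : z ! r₂ ≢ r₂
      lost-only : ∀ i → x ! i ≡ i → z ! i ≢ i → i ≡ r₁ ⊎ i ≡ r₂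

    r₁≢r₂ : r₁ ≢ r₂
    r₁≢r₂ e = <-irrefl (cong toℕ e) r₁<r₂

    -- each tag merges the x-block of one lost representative (moved) into the
    -- x-block of another representative (target)
    moved target : Tag → Fin n
    moved joins₂ = r₂
    moved joins₁ = r₁
    moved joins₁₂ = r₂
    target joins₂ = z ! r₂
    target joins₁ = z ! r₁
    target joins₁₂ = r₁

    moved-lost : ∀ t → moved t ≡ r₁ ⊎ moved t ≡ r₂
    moved-lost joins₂ = inj₂ refl
    moved-lost joins₁ = inj₁ refl
    moved-lost joins₁₂ = inj₂ refl

    target≢moved : ∀ t → target t ≢ moved t
    target≢moved joins₂ = z-r₂
    target≢moved joins₁ = z-r₁
    target≢moved joins₁₂ = r₁≢r₂

    Merged : Tag → Fin n → Fin n → Set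
    Merged t u v = (u ≡ moved t × v ≡ target t) ⊎ (u ≡ target t × v ≡ moved t)

  lostPair : (x z : Part n) (k : ℕ) → IsPartition x → IsPartition z → Refines x z →
    rank x ≡ k → rank z ≡ suc (suc k) → LostPair x z
  lostPair x z k px pz r rx rz =
    fromSupport (twoPointSupport (lostRep x z) (lostRep≤1 x z) (lostRep-count x z 2 k px pz r rx rz))
    where
    ordered : ∀ a b → toℕ a < toℕ b → 0 < lostRep x z a → 0 < lostRep x z b →
      (∀ i → 0 < lostRep x z i → i ≡ a ⊎ i ≡ b) → LostPair x z
    ordered a b lt pa pb cover = record
      { r₁ = a ; r₂ = b ; r₁<r₂ = lt
      ; x-r₁ = proj₁ (lostRep-pos x z a pa) ; x-r₂ = proj₁ (lostRep-pos x z b pb)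
      ; z-r₁ = proj₂ (lostRep-pos x z a pa) ; z-r₂ = proj₂ (lostRep-pos x z b pb)
      ; lost-only = λ i e ne → cover i (lostRep-pos⁻¹ x z i e ne) }
    fromSupport : (Σ (Fin n) λ a → Σ (Fin n) λ b → (0 < lostRep x z a) × (0 < lostRep x z b) × (a ≢ b) ×
      (∀ i → 0 < lostRep x z i → i ≡ a ⊎ i ≡ b)) → LostPair x z
    fromSupport (a , b , pa , pb , a≢b , cover) with <-cmp (toℕ a) (toℕ b)
    ... | tri< lt _ _ = ordered a b lt pa pb cover
    ... | tri≈ _ eq _ = ⊥-elim (a≢b (toℕ-injective eq))
    ... | tri> _ _ gt = ordered b a gt pb pa (λ i p → ⊎-swap (cover i p))

  target-rep : (x z : Part n) → IsPartition x → IsPartition z → Refines x z → (I : LostPair x z) →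
    ∀ t → x ! LostPair.target I t ≡ LostPair.target I t
  target-rep x z px pz rxz I joins₂ = rep-of-coarser x z px pz rxz _ (rep-idem z pz (LostPair.r₂ I))
  target-rep x z px pz rxz I joins₁ = rep-of-coarser x z px pz rxz _ (rep-idem z pz (LostPair.r₁ I))
  target-rep x z px pz rxz I joins₁₂ = LostPair.x-r₁ I

  Pattern : (x z : Part n) → LostPair x z → Tag → Part n → Set
  Pattern x z I joins₂ y = y ! LostPair.r₁ I ≡ LostPair.r₁ I × y ! LostPair.r₂ I ≡ z ! LostPair.r₂ I
  Pattern x z I joins₁ y = y ! LostPair.r₁ I ≡ z ! LostPair.r₁ I × y ! LostPair.r₂ I ≡ LostPair.r₂ I
  Pattern x z I joins₁₂ y = y ! LostPair.r₁ I ≡ LostPair.r₁ I × y ! LostPair.r₂ I ≡ LostPair.r₁ I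

  -- Every partition y strictly between x and z (one rank above x) follows a
  -- pattern: exactly one lost representative r stays a representative of y,
  -- and the other one is sent to a representative of z or to r.  (Opaque: only
  -- the resulting pattern matters, and unfolding the proof when comparing
  -- patterns would be costly.)
  opaque
    middlePattern : (x y z : Part n) (I : LostPair x z) → IsPartition x → IsPartition y → IsPartition z →
      Refines x y → Refines y z → (k : ℕ) → rank y ≡ suc k → rank z ≡ suc (suc k) →
      Σ Tag λ t → Pattern x z I t y
    middlePattern x y z I px py pz rxy ryz k ry rz = byKeptRep (lost-only r (x-rep r r-rep) r-lost)
      where
      open LostPair I
      single : Σ (Fin n) λ r → (0 < lostRep y z r) × (∀ i → 0 < lostRep y z i → i ≡ r)
      single = singleSupport (lostRep y z) (lostRep≤1 y z) (lostRep-count y z 1 (suc k) py pz ryz ry rz)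
      r : Fin n
      r = proj₁ single
      r-rep : y ! r ≡ r
      r-rep = proj₁ (lostRep-pos y z r (proj₁ (proj₂ single)))
      r-lost : z ! r ≢ r
      r-lost = proj₂ (lostRep-pos y z r (proj₁ (proj₂ single)))
      r-unique : ∀ i → y ! i ≡ i → z ! i ≢ i → i ≡ r
      r-unique i e ne = proj₂ (proj₂ single) i (lostRep-pos⁻¹ y z i e ne)
      x-rep : ∀ i → y ! i ≡ i → x ! i ≡ i
      x-rep = rep-of-coarser x y px py rxy
      repKind : ∀ i → z ! (y ! i) ≡ y ! i ⊎ (y ! i ≡ r₁ ⊎ y ! i ≡ r₂)
      repKind i with z ! (y ! i) ≟ y ! i
      ... | yes q = inj₁ q
      ... | no q = inj₂ (lost-only (y ! i) (x-rep (y ! i) (rep-idem y py i)) q)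
      toZ : ∀ i → z ! (y ! i) ≡ y ! i → y ! i ≡ z ! i
      toZ i q = trans (sym q) (sym (refines-rep y z py ryz i))
      byKeptRep : r ≡ r₁ ⊎ r ≡ r₂ → Σ Tag λ t → Pattern x z I t y
      byKeptRep (inj₁ refl) with repKind r₂
      ... | inj₁ q = joins₂ , r-rep , toZ r₂ q
      ... | inj₂ (inj₁ q) = joins₁₂ , r-rep , q
      ... | inj₂ (inj₂ q) = ⊥-elim (r₁≢r₂ (sym (r-unique r₂ q z-r₂)))
      byKeptRep (inj₂ refl) with repKind r₁
      ... | inj₁ q = joins₁ , toZ r₁ q , r-rep
      ... | inj₂ (inj₁ q) = ⊥-elim (r₁≢r₂ (r-unique r₁ q z-r₁))
      ... | inj₂ (inj₂ q) = ⊥-elim (<-irrefl refl (≤-<-trans (subst (λ w → toℕ w ≤ toℕ r₁) q (rep≤ y py r₁)) r₁<r₂))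

  -- A middle partition is determined by its values on the lost pair: every
  -- other block of x is already a block of z.
  middle-determined : (x y y' z : Part n) (I : LostPair x z) → IsPartition x → IsPartition y → IsPartition y' →
    IsPartition z → Refines x y → Refines y z → Refines x y' → Refines y' z →
    y ! LostPair.r₁ I ≡ y' ! LostPair.r₁ I → y ! LostPair.r₂ I ≡ y' ! LostPair.r₂ I → y ≡ y'
  middle-determined x y y' z I px py py' pz rxy ryz rxy' ry'z e₁ e₂ = vec-ext y y' agree
    where
    open LostPair I
    onRep : ∀ u → x ! u ≡ u → y ! u ≡ y' ! u
    onRep u xu with z ! u ≟ u
    ... | yes q = trans (rep-of-coarser y z py pz ryz u q) (sym (rep-of-coarser y' z py' pz ry'z u q))
    ... | no q with lost-only u xu q
    ... | inj₁ refl = e₁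
    ... | inj₂ refl = e₂
    agree : ∀ i → y ! i ≡ y' ! i
    agree i = trans (refines-rep x y px rxy i)
      (trans (onRep (x ! i) (rep-idem x px i)) (sym (refines-rep x y' px rxy' i)))

  record AllPatterns (x z : Part n) (k : ℕ) (I : LostPair x z) : Set where
    field
      witness : Tag → Part n
      witness-middle : ∀ t → Middle x z k (witness t)
      witness-pattern : ∀ t → Pattern x z I t (witness t)

  module RankTwo (x z : Part n) (px : IsPartition x) (pz : IsPartition z) (I : LostPair x z)
    (k : ℕ) (rkz : rank z ≡ suc (suc k)) where
    open LostPair I

    patternOf : (y : Part n) → Middle x z (suc k) y → Σ Tag λ t → Pattern x z I t y
    patternOf y (ncp , rk , rxy , ryz) = middlePattern x y z I px (proj₁ ncp) pz rxy ryz k rk rkz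

    samePattern : (y y' : Part n) → Middle x z (suc k) y → Middle x z (suc k) y' →
      (t : Tag) → Pattern x z I t y → Pattern x z I t y' → y ≡ y'
    samePattern y y' (ncp , _ , rxy , ryz) (ncp' , _ , rxy' , ry'z) t p p' =
      middle-determined x y y' z I px (proj₁ ncp) (proj₁ ncp') pz rxy ryz rxy' ry'z (at₁ t p p') (at₂ t p p')
      where
      at₁ : ∀ t → Pattern x z I t y → Pattern x z I t y' → y ! r₁ ≡ y' ! r₁
      at₁ joins₂ (a , _) (a' , _) = trans a (sym a')
      at₁ joins₁ (a , _) (a' , _) = trans a (sym a')
      at₁ joins₁₂ (a , _) (a' , _) = trans a (sym a')
      at₂ : ∀ t → Pattern x z I t y → Pattern x z I t y' → y ! r₂ ≡ y' ! r₂
      at₂ joins₂ (_ , b) (_ , b') = trans b (sym b')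
      at₂ joins₁ (_ , b) (_ , b') = trans b (sym b')
      at₂ joins₁₂ (_ , b) (_ , b') = trans b (sym b')

    -- r₂ cannot join r₁ inside z through z's representative: r₁ is not one
    zr₂≢r₁ : z ! r₂ ≢ r₁
    zr₂≢r₁ e = z-r₁ (trans (cong (z !_) (sym e)) (trans (rep-idem z pz r₂) e))

    patterns-differ : (y y' : Part n) (t t' : Tag) → Pattern x z I t y → Pattern x z I t' y' → t ≢ t' → y ≢ y'
    patterns-differ y y' t t' p p' ne refl = clash t t' p p' ne
      where
      clash : ∀ t t' → Pattern x z I t y → Pattern x z I t' y → t ≢ t' → ⊥
      clash joins₂ joins₂ _ _ ne = ne refl
      clash joins₁ joins₁ _ _ ne = ne refl
      clash joins₁₂ joins₁₂ _ _ ne = ne refl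
      clash joins₂ joins₁ (a , _) (a' , _) _ = z-r₁ (trans (sym a') a)
      clash joins₁ joins₂ (a , _) (a' , _) _ = z-r₁ (trans (sym a) a')
      clash joins₂ joins₁₂ (_ , b) (_ , b') _ = zr₂≢r₁ (trans (sym b) b')
      clash joins₁₂ joins₂ (_ , b) (_ , b') _ = zr₂≢r₁ (trans (sym b') b)
      clash joins₁ joins₁₂ (a , _) (a' , _) _ = z-r₁ (trans (sym a) a')
      clash joins₁₂ joins₁ (a , _) (a' , _) _ = z-r₁ (trans (sym a') a)

    three⇒allPatterns : ThreeMiddles x z (suc k) → AllPatterns x z (suc k) I
    three⇒allPatterns (y₁ , y₂ , y₃ , m₁ , m₂ , m₃ , (n₁₂ , n₁₃ , n₂₃) , _) = record
      { witness = λ t → proj₁ (pick t)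
      ; witness-middle = λ t → proj₁ (proj₂ (pick t))
      ; witness-pattern = λ t → proj₂ (proj₂ (pick t)) }
      where
      P₁ = patternOf y₁ m₁
      P₂ = patternOf y₂ m₂
      P₃ = patternOf y₃ m₃
      distinct : ∀ {y y'} (P : Σ Tag λ t → Pattern x z I t y) (P' : Σ Tag λ t → Pattern x z I t y') →
        Middle x z (suc k) y → Middle x z (suc k) y' → y ≢ y' → proj₁ P ≢ proj₁ P'
      distinct {y} {y'} (t , p) (.t , p') m m' ne refl = ne (samePattern y y' m m' t p p')
      pick : (t : Tag) → Σ (Part n) λ y → Middle x z (suc k) y × Pattern x z I t y
      pick t with tags-exhaust (distinct P₁ P₂ m₁ m₂ n₁₂) (distinct P₁ P₃ m₁ m₃ n₁₃) (distinct P₂ P₃ m₂ m₃ n₂₃) t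
      ... | inj₁ refl = y₁ , m₁ , proj₂ P₁
      ... | inj₂ (inj₁ refl) = y₂ , m₂ , proj₂ P₂
      ... | inj₂ (inj₂ refl) = y₃ , m₃ , proj₂ P₃

    allPatterns⇒three : AllPatterns x z (suc k) I → ThreeMiddles x z (suc k)
    allPatterns⇒three R =
      w joins₂ , w joins₁ , w joins₁₂ , wm joins₂ , wm joins₁ , wm joins₁₂ ,
      (differ joins₂ joins₁ (λ ()) , differ joins₂ joins₁₂ (λ ()) , differ joins₁ joins₁₂ (λ ())) , cover
      where
      open AllPatterns R renaming (witness to w; witness-middle to wm; witness-pattern to wp)
      differ : ∀ t t' → t ≢ t' → w t ≢ w t'
      differ t t' = patterns-differ (w t) (w t') t t' (wp t) (wp t')
      cover : (y : Part n) → Middle x z (suc k) y → y ≡ w joins₂ ⊎ y ≡ w joins₁ ⊎ y ≡ w joins₁₂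
      cover y my with patternOf y my
      ... | joins₂ , p = inj₁ (samePattern y _ my (wm joins₂) joins₂ p (wp joins₂))
      ... | joins₁ , p = inj₂ (inj₁ (samePattern y _ my (wm joins₁) joins₁ p (wp joins₁)))
      ... | joins₁₂ , p = inj₂ (inj₂ (samePattern y _ my (wm joins₁₂) joins₁₂ p (wp joins₁₂)))

module Extended (m : ℕ) where
  N : ℕ
  N = suc (suc (suc m))

  finest : Part N
  finest = tabulate (λ i → i)

  coarsest : Part N
  coarsest = replicate N fzero

  finest! : ∀ i → finest ! i ≡ i
  finest! i = lookup∘tabulate (λ i → i) i

  coarsest! : ∀ i → coarsest ! i ≡ fzero
  coarsest! i = lookup-replicate i fzero

  finest-ncp : IsNCP finest
  finest-ncp = finest-part , noCrossing
    where
    finest-part : IsPartition finest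
    finest-part i = subst (λ w → toℕ w ≤ toℕ i) (sym (finest! i)) ≤-refl , cong (finest !_) (finest! i)
    noCrossing : IsNonCrossing finest
    noCrossing a b c d ab bc cd ac bd = ⊥-elim (<-irrefl (cong toℕ a≡c) (<-trans ab bc))
      where
      a≡c : a ≡ c
      a≡c = trans (sym (finest! a)) (trans ac (finest! c))

  coarsest-same : ∀ i j → SameBlock coarsest i j
  coarsest-same i j = trans (coarsest! i) (sym (coarsest! j))

  coarsest-ncp : IsNCP coarsest
  coarsest-ncp = coarsest-part , λ a b c d _ _ _ _ _ → coarsest-same a b
    where
    coarsest-part : IsPartition coarsest
    coarsest-part i = subst (λ w → toℕ w ≤ toℕ i) (sym (coarsest! i)) z≤n , coarsest-same (coarsest ! i) i

  finest-refines : (v : Part N) → Refines finest v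
  finest-refines v i j e = cong (v !_) (trans (sym (finest! i)) (trans e (finest! j)))

  refines-coarsest : (v : Part N) → Refines v coarsest
  refines-coarsest v i j _ = coarsest-same i j

  finest-rank : rank finest ≡ 0
  finest-rank = trans (cong (N ∸_) (trans (numBlocks≡reps finest)
    (sumFin-ones (isRep finest) (λ i → isRep-yes finest i (finest! i))))) (n∸n≡0 N)

  coarsest-rank : rank coarsest ≡ suc (suc m)
  coarsest-rank = cong (N ∸_) (trans (numBlocks≡reps coarsest) oneRep)
    where
    oneRep : sumFin (isRep coarsest) ≡ 1
    oneRep = cong₂ _+_ (isRep-yes coarsest fzero refl)
      (sumFin-zero _ (λ i → isRep-no coarsest (fsuc i) (λ q → 0≢suc (trans (sym (coarsest! (fsuc i))) q))))
      where
      0≢suc : ∀ {k} {i : Fin k} → fzero {k} ≢ fsuc i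
      0≢suc ()

  entryOrTop : {l : ℕ} → Vec (Part N) l → ℕ → Part N
  entryOrTop [] k = coarsest
  entryOrTop (a ∷ v) zero = a
  entryOrTop (a ∷ v) (suc k) = entryOrTop v k

  entryOrTop-lookup : {l : ℕ} (v : Vec (Part N) l) (k : Fin l) → entryOrTop v (toℕ k) ≡ lookup v k
  entryOrTop-lookup (a ∷ v) fzero = refl
  entryOrTop-lookup (a ∷ v) (fsuc k) = entryOrTop-lookup v k

  entryOrTop-past : {l : ℕ} (v : Vec (Part N) l) (k : ℕ) → l ≤ k → entryOrTop v k ≡ coarsest
  entryOrTop-past [] k _ = refl
  entryOrTop-past (a ∷ v) (suc k) (s≤s le) = entryOrTop-past v k le

  entryOrTop-in : {l : ℕ} (v : Vec (Part N) l) (k : ℕ) (p : k < l) → entryOrTop v k ≡ lookup v (fromℕ< p)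
  entryOrTop-in v k p = trans (cong (entryOrTop v) (sym (toℕ-fromℕ< p))) (entryOrTop-lookup v (fromℕ< p))

  -- the chain extended by the finest and the coarsest partition: entry k has rank k
  ext : Vec (Part N) (suc m) → ℕ → Part N
  ext D zero = finest
  ext D (suc k) = entryOrTop D k

  ext-lookup : (D : Vec (Part N) (suc m)) (k : Fin (suc m)) → ext D (suc (toℕ k)) ≡ lookup D k
  ext-lookup D k = entryOrTop-lookup D k

  module ExtendedChamber (D : Vec (Part N) (suc m)) (ch : IsChamber {N} D) where
    ext-ncp : ∀ k → IsNCP (ext D k)
    ext-ncp zero = finest-ncp
    ext-ncp (suc k) with k <? suc m
    ... | yes p = subst IsNCP (sym (entryOrTop-in D k p)) (proj₁ ch (fromℕ< p))
    ... | no np = subst IsNCP (sym (entryOrTop-past D k (≮⇒≥ np))) coarsest-ncp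

    ext-part : ∀ k → IsPartition (ext D k)
    ext-part k = proj₁ (ext-ncp k)

    ext-rank : ∀ k → k ≤ suc (suc m) → rank (ext D k) ≡ k
    ext-rank zero _ = finest-rank
    ext-rank (suc k) le with k <? suc m
    ... | yes p = trans (cong rank (entryOrTop-in D k p)) (trans (proj₁ (proj₂ ch) (fromℕ< p)) (cong suc (toℕ-fromℕ< p)))
    ... | no np = trans (cong rank (entryOrTop-past D k (≮⇒≥ np)))
                    (trans coarsest-rank (cong suc (≤-antisym (≮⇒≥ np) (s≤s⁻¹ le))))

    ext-refines : ∀ a b → a ≤ b → Refines (ext D a) (ext D b)
    ext-refines zero b _ = finest-refines (ext D b)
    ext-refines (suc a) (suc b) (s≤s le) with b <? suc m
    ... | no nb = subst (Refines (entryOrTop D a)) (sym (entryOrTop-past D b (≮⇒≥ nb))) (refines-coarsest (entryOrTop D a))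
    ... | yes pb with <-cmp a b
    ... | tri≈ _ refl _ = λ i j e → e
    ... | tri> _ _ gt = ⊥-elim (<-irrefl refl (<-≤-trans gt le))
    ... | tri< lt _ _ = subst₂ Refines (sym (entryOrTop-in D a pa)) (sym (entryOrTop-in D b pb))
            (proj₂ (proj₂ ch) (fromℕ< pa) (fromℕ< pb) (subst₂ _<_ (sym (toℕ-fromℕ< pa)) (sym (toℕ-fromℕ< pb)) lt))
      where
      pa : a < suc m
      pa = <-trans lt pb

  -- The chambers containing the face C ∖ {C_j} are the chains C[j ≔ y] for the
  -- middle elements y of the rank-two interval [ext C j , ext C (j+2)].
  module Face (C : Vec (Part N) (suc m)) (chC : IsChamber {N} C) (j : Fin (suc m)) where
    open ExtendedChamber C chC
    j' = toℕ j
    below = ext C j'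
    above = ext C (suc (suc j'))

    face-ext : (D : Vec (Part N) (suc m)) → ContainsFace {N} C j D → ∀ k → k ≢ suc j' → ext D k ≡ ext C k
    face-ext D cf zero _ = refl
    face-ext D cf (suc k) ne with k <? suc m
    ... | yes p = trans (entryOrTop-in D k p) (trans (cf (fromℕ< p) notj) (sym (entryOrTop-in C k p)))
      where
      notj : fromℕ< p ≢ j
      notj e = ne (cong suc (trans (sym (toℕ-fromℕ< p)) (cong toℕ e)))
    ... | no np = trans (entryOrTop-past D k (≮⇒≥ np)) (sym (entryOrTop-past C k (≮⇒≥ np)))

    chamber→middle : (D : Vec (Part N) (suc m)) → IsChamber {N} D → ContainsFace {N} C j D →
      Middle below above (suc j') (lookup D j)
    chamber→middle D chD cf = proj₁ chD j , proj₁ (proj₂ chD) j , fromBelow , toAbove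
      where
      open ExtendedChamber D chD using () renaming (ext-refines to D-refines)
      fromBelow : Refines below (lookup D j)
      fromBelow = subst₂ Refines (face-ext D cf j' (λ e → <-irrefl e (n<1+n j'))) (ext-lookup D j)
        (D-refines j' (suc j') (n≤1+n j'))
      toAbove : Refines (lookup D j) above
      toAbove = subst₂ Refines (ext-lookup D j) (face-ext D cf (suc (suc j')) (λ e → <-irrefl (sym e) (n<1+n (suc j'))))
        (D-refines (suc j') (suc (suc j')) (n≤1+n (suc j')))

    face-determined : (D D' : Vec (Part N) (suc m)) → ContainsFace {N} C j D → ContainsFace {N} C j D' →
      lookup D j ≡ lookup D' j → D ≡ D'
    face-determined D D' cf cf' e = vec-ext D D' agree
      where
      agree : ∀ k → lookup D k ≡ lookup D' k
      agree k with k ≟ j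
      ... | yes refl = e
      ... | no ne = trans (cf k ne) (sym (cf' k ne))

    update-face : ∀ y → ContainsFace {N} C j (C [ j ]≔ y)
    update-face y k ne = lookup∘update′ ne C y

    middle→chamber : (y : Part N) → Middle below above (suc j') y →
      IsChamber {N} (C [ j ]≔ y) × ContainsFace {N} C j (C [ j ]≔ y)
    middle→chamber y (ncp , rk , rxy , ryz) = (ncpD , rkD , refD) , cf
      where
      D = C [ j ]≔ y
      cf : ContainsFace {N} C j D
      cf = update-face y
      Dk : ∀ k → k ≢ j → lookup D k ≡ ext C (suc (toℕ k))
      Dk k ne = trans (cf k ne) (sym (ext-lookup C k))
      Dj : lookup D j ≡ y
      Dj = lookup∘update j C y
      ncpD : ∀ k → IsNCP (lookup D k)
      ncpD k with k ≟ j
      ... | yes refl = subst IsNCP (sym Dj) ncp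
      ... | no ne = subst IsNCP (sym (cf k ne)) (proj₁ chC k)
      rkD : ∀ k → rank (lookup D k) ≡ suc (toℕ k)
      rkD k with k ≟ j
      ... | yes refl = trans (cong rank Dj) rk
      ... | no ne = trans (cong rank (cf k ne)) (proj₁ (proj₂ chC) k)
      refD : ∀ k l → toℕ k < toℕ l → Refines (lookup D k) (lookup D l)
      refD k l lt with k ≟ j | l ≟ j
      ... | yes refl | yes refl = ⊥-elim (<-irrefl refl lt)
      ... | yes refl | no nl = subst₂ Refines (sym Dj) (sym (Dk l nl))
             (refines-trans y above (ext C (suc (toℕ l))) ryz (ext-refines _ _ (s≤s lt)))
      ... | no nk | yes refl = subst₂ Refines (sym (Dk k nk)) (sym Dj)
             (refines-trans (ext C (suc (toℕ k))) below y (ext-refines _ _ lt) rxy)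
      ... | no nk | no nl = subst₂ Refines (sym (cf k nk)) (sym (cf l nl)) (proj₂ (proj₂ chC) k l lt)

    vertex : Vec (Part N) (suc m) → Part N
    vertex D = lookup D j

    chamberOf : Part N → Vec (Part N) (suc m)
    chamberOf y = C [ j ]≔ y

    vertex-chamberOf : ∀ y → vertex (chamberOf y) ≡ y
    vertex-chamberOf y = lookup∘update j C y

    threeChambers⇒threeMiddles : InExactlyThreeChambers {N} C j → ThreeMiddles below above (suc j')
    threeChambers⇒threeMiddles (D₁ , D₂ , D₃ , (c₁ , f₁) , (c₂ , f₂) , (c₃ , f₃) , (n₁₂ , n₁₃ , n₂₃) , cover) =
      vertex D₁ , vertex D₂ , vertex D₃ , chamber→middle D₁ c₁ f₁ , chamber→middle D₂ c₂ f₂ , chamber→middle D₃ c₃ f₃ ,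
      (differ f₁ f₂ n₁₂ , differ f₁ f₃ n₁₃ , differ f₂ f₃ n₂₃) , cover'
      where
      differ : ∀ {D D'} → ContainsFace {N} C j D → ContainsFace {N} C j D' → D ≢ D' → vertex D ≢ vertex D'
      differ {D} {D'} f f' ne e = ne (face-determined D D' f f' e)
      cover' : (y : Part N) → Middle below above (suc j') y → y ≡ vertex D₁ ⊎ y ≡ vertex D₂ ⊎ y ≡ vertex D₃
      cover' y my with middle→chamber y my
      ... | chy , cfy with cover (chamberOf y) chy cfy
      ... | inj₁ e = inj₁ (trans (sym (vertex-chamberOf y)) (cong vertex e))
      ... | inj₂ (inj₁ e) = inj₂ (inj₁ (trans (sym (vertex-chamberOf y)) (cong vertex e)))
      ... | inj₂ (inj₂ e) = inj₂ (inj₂ (trans (sym (vertex-chamberOf y)) (cong vertex e)))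

    threeMiddles⇒threeChambers : ThreeMiddles below above (suc j') → InExactlyThreeChambers {N} C j
    threeMiddles⇒threeChambers (y₁ , y₂ , y₃ , m₁ , m₂ , m₃ , (n₁₂ , n₁₃ , n₂₃) , cover) =
      chamberOf y₁ , chamberOf y₂ , chamberOf y₃ , middle→chamber y₁ m₁ , middle→chamber y₂ m₂ , middle→chamber y₃ m₃ ,
      (differ n₁₂ , differ n₁₃ , differ n₂₃) , cover'
      where
      differ : ∀ {y y'} → y ≢ y' → chamberOf y ≢ chamberOf y'
      differ {y} {y'} ne e = ne (trans (sym (vertex-chamberOf y)) (trans (cong vertex e) (vertex-chamberOf y')))
      same : ∀ D {y} → ContainsFace {N} C j D → vertex D ≡ y → D ≡ chamberOf y
      same D {y} cfD e = face-determined D (chamberOf y) cfD (update-face y) (trans e (sym (vertex-chamberOf y)))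
      cover' : (D : Vec (Part N) (suc m)) → IsChamber {N} D → ContainsFace {N} C j D →
        D ≡ chamberOf y₁ ⊎ D ≡ chamberOf y₂ ⊎ D ≡ chamberOf y₃
      cover' D chD cfD with cover (vertex D) (chamber→middle D chD cfD)
      ... | inj₁ e = inj₁ (same D cfD e)
      ... | inj₂ (inj₁ e) = inj₂ (inj₁ (same D cfD e))
      ... | inj₂ (inj₂ e) = inj₂ (inj₂ (same D cfD e))

-- The circular arc of length l starting at s: the j with s ≤ j < s + l, or
-- with j + n < s + l (the part that wraps around past n-1).
InArc : {n : ℕ} → Fin n → ℕ → Fin n → Set
InArc {n} s l j = (toℕ s ≤ toℕ j × toℕ j < toℕ s + l) ⊎ (toℕ j + n < toℕ s + l)

module _ {n : ℕ} where
  singleton-arc : (v : Part n) (j : Fin n) → (∀ w → SameBlock v j w → w ≡ j) → CircConsecBlockAt v j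
  singleton-arc v j single = j , 1 , ≤-trans (s≤s z≤n) (toℕ<n j) , λ w → to w , from w
    where
    j<j+1 : toℕ j < toℕ j + 1
    j<j+1 = subst (toℕ j <_) (+-comm 1 (toℕ j)) (n<1+n (toℕ j))
    to : ∀ w → SameBlock v j w → InArc j 1 w
    to w e rewrite single w e = inj₁ (≤-refl , j<j+1)
    from : ∀ w → InArc j 1 w → SameBlock v j w
    from w (inj₁ (j≤w , w<j+1)) =
      cong (v !_) (sym (toℕ-injective (≤-antisym (s≤s⁻¹ (subst (toℕ w <_) (+-comm (toℕ j) 1) w<j+1)) j≤w)))
    from w (inj₂ wraps) = ⊥-elim (<-irrefl refl
      (<-≤-trans (subst (toℕ w + n <_) (+-comm (toℕ j) 1) wraps) (≤-trans (toℕ<n j) (m≤n+m n (toℕ w)))))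

  arc-transport : (v : Part n) (i j : Fin n) → SameBlock v i j → CircConsecBlockAt v i → CircConsecBlockAt v j
  arc-transport v i j e (s , l , le , h) =
    s , l , le , λ w → (λ q → proj₁ (h w) (trans e q)) , (λ q → trans (sym e) (proj₂ (h w) q))

  universal-arcs : (v : Part n) → IsUniversal v → ∀ j → CircConsecBlockAt v j
  universal-arcs v (i , nti , single , arc) j with v ! i ≟ v ! j
  ... | yes e = arc-transport v i j e arc
  ... | no ne = singleton-arc v j alone
    where
    alone : ∀ w → SameBlock v j w → w ≡ j
    alone w e with w ≟ j
    ... | yes q = q
    ... | no q = ⊥-elim (ne (single i j nti (w , q , e)))

  arc-noCrossing₁ : (v : Part n) (a b c d : Fin n) → CircConsecBlockAt v a →
    toℕ a < toℕ b → toℕ b < toℕ c → toℕ c < toℕ d →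
    SameBlock v a c → ¬ SameBlock v a b → ¬ SameBlock v a d → ⊥
  arc-noCrossing₁ v a b c d (s , l , _ , h) ab bc cd ac nab nad with proj₁ (h a) refl | proj₁ (h c) ac
  ... | inj₁ (sa , al) | inj₁ (sc , cl) = nab (proj₂ (h b) (inj₁ (≤-trans sa (<⇒≤ ab) , <-trans bc cl)))
  ... | inj₁ (sa , al) | inj₂ cn = ⊥-elim (<-irrefl refl (<-≤-trans (≤-<-trans (m≤m+n (toℕ c) n) cn) end≤c))
    where
    end≤c : toℕ s + l ≤ toℕ c
    end≤c with toℕ b <? toℕ s + l
    ... | yes bl = ⊥-elim (nab (proj₂ (h b) (inj₁ (≤-trans sa (<⇒≤ ab) , bl))))
    ... | no nbl = ≤-trans (≮⇒≥ nbl) (<⇒≤ bc)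
  ... | inj₂ an | inj₂ cn with toℕ b + n <? toℕ s + l
  ... | yes bn = nab (proj₂ (h b) (inj₂ bn))
  ... | no nbn = ⊥-elim (<-irrefl refl (<-≤-trans cn (≤-trans (≮⇒≥ nbn) (+-monoˡ-≤ n (<⇒≤ bc)))))
  arc-noCrossing₁ v a b c d (s , l , _ , h) ab bc cd ac nab nad | inj₂ an | inj₁ (sc , cl) =
    nad (proj₂ (h d) (inj₁ (≤-trans sc (<⇒≤ cd) , <-trans (<-≤-trans (toℕ<n d) (m≤n+m n (toℕ a))) an)))

  arc-noCrossing₂ : (v : Part n) (a b c d : Fin n) → CircConsecBlockAt v b →
    toℕ a < toℕ b → toℕ b < toℕ c → toℕ c < toℕ d →
    SameBlock v b d → ¬ SameBlock v b a → ¬ SameBlock v b c → ⊥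
  arc-noCrossing₂ v a b c d (s , l , _ , h) ab bc cd bd nba nbc with proj₁ (h b) refl
  ... | inj₂ bn = nba (proj₂ (h a) (inj₂ (<-trans (+-monoˡ-< n ab) bn)))
  ... | inj₁ (sb , bl) with proj₁ (h d) bd
  ... | inj₁ (sd , dl) = nbc (proj₂ (h c) (inj₁ (≤-trans sb (<⇒≤ bc) , <-trans cd dl)))
  ... | inj₂ dn with toℕ c <? toℕ s + l
  ... | yes cl = nbc (proj₂ (h c) (inj₁ (≤-trans sb (<⇒≤ bc) , cl)))
  ... | no ncl = ⊥-elim (<-irrefl refl (≤-<-trans (≤-trans (≮⇒≥ ncl) (<⇒≤ cd)) (≤-<-trans (m≤m+n (toℕ d) n) dn)))

  -- Merging, in a rank-two step x ≤ z, the x-block of the lost representative t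
  -- into the x-block of a representative M < t of the same z-block gives a
  -- middle partition y = g ∘ x, where g sends t to M.  If all x-blocks are arcs,
  -- y is non-crossing: a crossing of y would involve a single x-block.
  module MergeInto (x z : Part n) (px : IsPartition x) (pz : IsPartition z) (rxz : Refines x z)
    (k : ℕ) (rkz : rank z ≡ suc (suc k)) (I : LostPair x z) (t M : Fin n)
    (t-lost : t ≡ LostPair.r₁ I ⊎ t ≡ LostPair.r₂ I) (x-M : x ! M ≡ M) (M≢t : M ≢ t) (M≤t : toℕ M ≤ toℕ t)
    (z-M : z ! M ≡ z ! t) where
    open LostPair I

    g : Fin n → Fin n
    g w with w ≟ t
    ... | yes _ = M
    ... | no _ = w

    g-t : g t ≡ M
    g-t with t ≟ t
    ... | yes _ = refl
    ... | no ne = ⊥-elim (ne refl)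

    g-other : ∀ w → w ≢ t → g w ≡ w
    g-other w ne with w ≟ t
    ... | yes e = ⊥-elim (ne e)
    ... | no _ = refl

    g-rep : ∀ w → x ! w ≡ w → x ! (g w) ≡ g w
    g-rep w e with w ≟ t
    ... | yes _ = x-M
    ... | no _ = e

    g-idem : ∀ w → g (g w) ≡ g w
    g-idem w with w ≟ t
    ... | yes _ = g-other M M≢t
    ... | no ne = g-other w ne

    g-≤ : ∀ w → toℕ (g w) ≤ toℕ w
    g-≤ w with w ≟ t
    ... | yes refl = M≤t
    ... | no _ = ≤-refl

    g-z : ∀ w → z ! (g w) ≡ z ! w
    g-z w with w ≟ t
    ... | yes refl = z-M
    ... | no _ = refl

    y : Part n
    y = tabulate (λ i → g (x ! i))

    y! : ∀ i → y ! i ≡ g (x ! i)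
    y! i = lookup∘tabulate (λ i → g (x ! i)) i

    y-part : IsPartition y
    y-part i = subst (λ w → toℕ w ≤ toℕ i) (sym (y! i)) (≤-trans (g-≤ (x ! i)) (rep≤ x px i)) ,
      trans (y! (y ! i)) (trans (cong (λ w → g (x ! w)) (y! i))
        (trans (cong g (g-rep (x ! i) (rep-idem x px i))) (trans (g-idem (x ! i)) (sym (y! i)))))

    x-refines-y : Refines x y
    x-refines-y i j e = trans (y! i) (trans (cong g e) (sym (y! j)))

    z-via-y : ∀ i → z ! i ≡ z ! (y ! i)
    z-via-y i = trans (refines-rep x z px rxz i) (trans (sym (g-z (x ! i))) (cong (z !_) (sym (y! i))))

    y-refines-z : Refines y z
    y-refines-z i j e = trans (z-via-y i) (trans (cong (z !_) e) (sym (z-via-y j)))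

    y-on-rep : ∀ r → x ! r ≡ r → y ! r ≡ g r
    y-on-rep r e = trans (y! r) (cong g e)

    -- y loses exactly one representative on the way to z: the lost one other than t
    y-rank : rank y ≡ suc k
    y-rank = rank-from-reps y z 1 (suc k)
      (trans (reps-refine y z y-part pz y-refines-z) (cong (sumFin (isRep z) +_) oneLost)) rkz
      where
      support : ∀ i → 0 < lostRep y z i → i ≡ r₁ ⊎ i ≡ r₂
      support i p with lostRep-pos y z i p
      ... | e₁ , e₂ = lost-only i (rep-of-coarser x y px y-part x-refines-y i e₁) e₂
      x-t : x ! t ≡ t
      x-t = [ (λ e → subst (λ w → x ! w ≡ w) (sym e) x-r₁) , (λ e → subst (λ w → x ! w ≡ w) (sym e) x-r₂) ]′ t-lost
      t-kept : lostRep y z t ≡ 0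
      t-kept = trans (cong (_∸ isRep z t) (isRep-no y t (λ e → M≢t (trans (sym (trans (y-on-rep t x-t) g-t)) e))))
        (0∸n≡0 (isRep z t))
      other-lost : ∀ o → x ! o ≡ o → z ! o ≢ o → o ≢ t → lostRep y z o ≡ 1
      other-lost o e₁ e₂ ne = cong₂ _∸_ (isRep-yes y o (trans (y-on-rep o e₁) (g-other o ne))) (isRep-no z o e₂)
      oneLost : sumFin (lostRep y z) ≡ 1
      oneLost = trans (sumFin-twoPoints (lostRep y z) r₁ r₂ r₁≢r₂ support) (byLost t-lost)
        where
        byLost : t ≡ r₁ ⊎ t ≡ r₂ → lostRep y z r₁ + lostRep y z r₂ ≡ 1
        byLost (inj₁ e) = cong₂ _+_ (trans (cong (lostRep y z) (sym e)) t-kept)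
          (other-lost r₂ x-r₂ z-r₂ (λ q → r₁≢r₂ (sym (trans q e))))
        byLost (inj₂ e) = cong₂ _+_ (other-lost r₁ x-r₁ z-r₁ (λ q → r₁≢r₂ (trans q e)))
          (trans (cong (lostRep y z) (sym e)) t-kept)

    unmerged-block : ∀ i j → y ! i ≢ M → y ! j ≡ y ! i → x ! j ≡ x ! i
    unmerged-block i j ne e = trans (sym (g-other (x ! j) j-ok)) (trans (sym (y! j)) (trans e (trans (y! i) (g-other (x ! i) i-ok))))
      where
      i-ok : x ! i ≢ t
      i-ok q = ne (trans (y! i) (trans (cong g q) g-t))
      j-ok : x ! j ≢ t
      j-ok q = ne (trans (sym e) (trans (y! j) (trans (cong g q) g-t)))

    y-noncrossing : (∀ i → CircConsecBlockAt x i) → IsNonCrossing y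
    y-noncrossing arcs a b c d ab bc cd ac bd with y ! a ≟ y ! b
    ... | yes e = e
    ... | no nab with y ! a ≟ M
    ... | no naM = ⊥-elim (arc-noCrossing₁ x a b c d (arcs a) ab bc cd (sym (unmerged-block a c naM (sym ac)))
                     (λ q → nab (x-refines-y a b q)) (λ q → nab (trans (x-refines-y a d q) (sym bd))))
    ... | yes aM = ⊥-elim (arc-noCrossing₂ x a b c d (arcs b) ab bc cd (sym (unmerged-block b d nbM (sym bd)))
                     (λ q → nab (sym (x-refines-y b a q))) (λ q → nab (trans ac (sym (x-refines-y b c q)))))
      where
      nbM : y ! b ≢ M
      nbM q = nab (trans aM (sym q))

    merge-middle : (∀ i → CircConsecBlockAt x i) → Middle x z (suc k) y
    merge-middle arcs = (y-part , y-noncrossing arcs) , y-rank , x-refines-y , y-refines-z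

  -- If all blocks of x are arcs and z has a single non-trivial block, each
  -- pattern is realised by a merge: joins₂ merges r₂ into z r₂, joins₁ merges
  -- r₁ into z r₁, and joins₁₂ merges r₂ into r₁ (same z-block, as z has one).
  arcs⇒allPatterns : (x z : Part n) (px : IsPartition x) (pz : IsPartition z) (rxz : Refines x z)
    (k : ℕ) (rkz : rank z ≡ suc (suc k)) (I : LostPair x z) →
    (∀ i → CircConsecBlockAt x i) →
    (∀ j l → NonTrivialBlockAt z j → NonTrivialBlockAt z l → SameBlock z j l) →
    AllPatterns x z (suc k) I
  arcs⇒allPatterns x z px pz rxz k rkz I arcs single = record
    { witness = λ t → Merge.y t
    ; witness-middle = λ t → Merge.merge-middle t arcs
    ; witness-pattern = realised }
    where
    open LostPair I
    nonTrivial : ∀ r → z ! r ≢ r → NonTrivialBlockAt z r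
    nonTrivial r ne = z ! r , ne , sym (rep-idem z pz r)
    target≤moved : ∀ t → toℕ (target t) ≤ toℕ (moved t)
    target≤moved joins₂ = rep≤ z pz r₂
    target≤moved joins₁ = rep≤ z pz r₁
    target≤moved joins₁₂ = <⇒≤ r₁<r₂
    z-target : ∀ t → z ! target t ≡ z ! moved t
    z-target joins₂ = rep-idem z pz r₂
    z-target joins₁ = rep-idem z pz r₁
    z-target joins₁₂ = single r₁ r₂ (nonTrivial r₁ z-r₁) (nonTrivial r₂ z-r₂)
    module Merge (t : Tag) = MergeInto x z px pz rxz k rkz I (moved t) (target t)
      (moved-lost t) (target-rep x z px pz rxz I t) (target≢moved t) (target≤moved t) (z-target t)
    realised : ∀ t → Pattern x z I t (Merge.y t)
    realised joins₂ = trans (y-on-rep r₁ x-r₁) (g-other r₁ r₁≢r₂) , trans (y-on-rep r₂ x-r₂) g-t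
      where open Merge joins₂
    realised joins₁ = trans (y-on-rep r₁ x-r₁) g-t , trans (y-on-rep r₂ x-r₂) (g-other r₂ (≢-sym r₁≢r₂))
      where open Merge joins₁
    realised joins₁₂ = trans (y-on-rep r₁ x-r₁) (g-other r₁ r₁≢r₂) , trans (y-on-rep r₂ x-r₂) g-t
      where open Merge joins₁₂

-- (⇒) In a universal chamber every face lies in exactly three chambers: below
-- each face all blocks are arcs, and above it there is one non-trivial block.
module UniversalChamber (m : ℕ) (C : Vec (Part (Extended.N m)) (suc m)) (chC : IsChamber {Extended.N m} C)
  (U : IsUniversalChamber {Extended.N m} C) where
  open Extended m
  open ExtendedChamber C chC

  finest-arcs : ∀ i → CircConsecBlockAt finest i
  finest-arcs i = singleton-arc finest i (λ w e → sym (trans (sym (finest! i)) (trans e (finest! w))))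

  ext-arcs : ∀ k → k ≤ suc m → ∀ i → CircConsecBlockAt (ext C k) i
  ext-arcs zero _ = finest-arcs
  ext-arcs (suc k) (s≤s le) = subst (λ v → ∀ i → CircConsecBlockAt v i) (sym (entryOrTop-in C k (s≤s le)))
    (universal-arcs (lookup C (fromℕ< (s≤s le))) (U (fromℕ< (s≤s le))))

  OneNonTrivialBlock : Part N → Set
  OneNonTrivialBlock v = ∀ j l → NonTrivialBlockAt v j → NonTrivialBlockAt v l → SameBlock v j l

  ext-oneBlock : ∀ k → OneNonTrivialBlock (ext C (suc k))
  ext-oneBlock k with k <? suc m
  ... | yes p = subst OneNonTrivialBlock (sym (entryOrTop-in C k p)) (proj₁ (proj₂ (proj₂ (U (fromℕ< p)))))
  ... | no np = subst OneNonTrivialBlock (sym (entryOrTop-past C k (≮⇒≥ np))) (λ j l _ _ → coarsest-same j l)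

  everyFaceThree : (j : Fin (suc m)) → InExactlyThreeChambers {N} C j
  everyFaceThree j = threeMiddles⇒threeChambers
    (RankTwo.allPatterns⇒three below above px pz I j' rkz
      (arcs⇒allPatterns below above px pz rxz j' rkz I (ext-arcs j' j'≤) (ext-oneBlock (suc j'))))
    where
    open Face C chC j
    j'≤ : j' ≤ suc m
    j'≤ = ≤-trans (s≤s⁻¹ (toℕ<n j)) (n≤1+n m)
    px = ext-part j'
    pz = ext-part (suc (suc j'))
    rxz = ext-refines j' (suc (suc j')) (≤-trans (n≤1+n j') (n≤1+n _))
    rkz = ext-rank (suc (suc j')) (s≤s (s≤s (s≤s⁻¹ (toℕ<n j))))
    I = lostPair below above j' px pz rxz (ext-rank j' (≤-trans j'≤ (n≤1+n _))) rkz

IsArc : {n : ℕ} → (Fin n → Set) → Set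
IsArc {n} P = Σ (Fin n) λ s → Σ ℕ λ l → l ≤ n × ∀ w → (P w → InArc s l w) × (InArc s l w → P w)

-- Positions measured by their circular offset o < n from a base point s₀:
-- w is at offset o when s₀ + o is toℕ w or toℕ w + n.  Arcs starting at s₀ are
-- offset intervals [0, l), and offsets increasing from 0 meet points in the
-- circular order, which is what non-crossing is invariant under.
module Offsets {n : ℕ} (s₀ : Fin n) where
  base : ℕ
  base = toℕ s₀

  AtOffset : Fin n → ℕ → Set
  AtOffset w o = (base + o ≡ toℕ w) ⊎ (base + o ≡ toℕ w + n)

  offset : Fin n → ℕ
  offset w with base ≤? toℕ w
  ... | yes _ = toℕ w ∸ base
  ... | no _ = toℕ w + n ∸ base

  offset-spec : ∀ w → AtOffset w (offset w) × offset w < n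
  offset-spec w with base ≤? toℕ w
  ... | yes le = inj₁ (m+[n∸m]≡n le) , ≤-<-trans (m∸n≤m (toℕ w) base) (toℕ<n w)
  ... | no nle = inj₂ (m+[n∸m]≡n le') ,
        +-cancelˡ-< base _ n (subst (_< base + n) (sym (m+[n∸m]≡n le')) (+-monoˡ-< n (≰⇒> nle)))
    where
    le' : base ≤ toℕ w + n
    le' = ≤-trans (<⇒≤ (toℕ<n s₀)) (m≤n+m n (toℕ w))

  at-offset : ∀ w → AtOffset w (offset w)
  at-offset w = proj₁ (offset-spec w)

  offset<n : ∀ w → offset w < n
  offset<n w = proj₂ (offset-spec w)

  inArc⇒offset< : ∀ l w o → l ≤ n → o < n → AtOffset w o → InArc s₀ l w → o < l
  inArc⇒offset< l w o ln on (inj₁ e) (inj₁ (_ , wl)) = +-cancelˡ-< base o l (subst (_< base + l) (sym e) wl)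
  inArc⇒offset< l w o ln on (inj₁ e) (inj₂ wl) = ⊥-elim (<-irrefl refl (<-≤-trans o+n<n (m≤n+m n o)))
    where
    o+n<n : o + n < n
    o+n<n = +-cancelˡ-< base (o + n) n
      (<-≤-trans (subst (_< base + l) (trans (cong (_+ n) (sym e)) (+-assoc base o n)) wl) (+-monoʳ-≤ base ln))
  inArc⇒offset< l w o ln on (inj₂ e) (inj₁ (sw , _)) =
    ⊥-elim (<-irrefl refl (<-≤-trans on (+-cancelˡ-≤ base n o (subst (base + n ≤_) (sym e) (+-monoˡ-≤ n sw)))))
  inArc⇒offset< l w o ln on (inj₂ e) (inj₂ wl) = +-cancelˡ-< base o l (subst (_< base + l) (sym e) wl)

  offset<⇒inArc : ∀ l w o → AtOffset w o → o < l → InArc s₀ l w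
  offset<⇒inArc l w o (inj₁ e) ol = inj₁ (subst (base ≤_) e (m≤m+n base o) , subst (_< base + l) e (+-monoʳ-< base ol))
  offset<⇒inArc l w o (inj₂ e) ol = inj₂ (subst (_< base + l) e (+-monoʳ-< base ol))

  offset-injective : ∀ w w' o → AtOffset w o → AtOffset w' o → w ≡ w'
  offset-injective w w' o (inj₁ e) (inj₁ e') = toℕ-injective (trans (sym e) e')
  offset-injective w w' o (inj₂ e) (inj₂ e') = toℕ-injective (+-cancelʳ-≡ n _ _ (trans (sym e) e'))
  offset-injective w w' o (inj₁ e) (inj₂ e') =
    ⊥-elim (<-irrefl refl (<-≤-trans (toℕ<n w) (subst (n ≤_) (trans (sym e') e) (m≤n+m n (toℕ w')))))
  offset-injective w w' o (inj₂ e) (inj₁ e') =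
    ⊥-elim (<-irrefl refl (<-≤-trans (toℕ<n w') (subst (n ≤_) (trans (sym e) e') (m≤n+m n (toℕ w)))))

  offset-unique : ∀ w o o' → o < n → o' < n → AtOffset w o → AtOffset w o' → o ≡ o'
  offset-unique w o o' on on' (inj₁ e) (inj₁ e') = +-cancelˡ-≡ base o o' (trans e (sym e'))
  offset-unique w o o' on on' (inj₂ e) (inj₂ e') = +-cancelˡ-≡ base o o' (trans e (sym e'))
  offset-unique w o o' on on' (inj₁ e) (inj₂ e') = ⊥-elim (noWrap o o' w e e' on')
    where
    noWrap : ∀ a b (w : Fin n) → base + a ≡ toℕ w → base + b ≡ toℕ w + n → b < n → ⊥
    noWrap a b w e e' bn = <-irrefl refl (<-≤-trans bn (subst (n ≤_) (sym b≡a+n) (m≤n+m n a)))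
      where
      b≡a+n : b ≡ a + n
      b≡a+n = +-cancelˡ-≡ base b (a + n) (trans e' (trans (cong (_+ n) (sym e)) (+-assoc base a n)))
  offset-unique w o o' on on' (inj₂ e) (inj₁ e') = sym (offset-unique w o' o on' on (inj₁ e') (inj₂ e))

  pointAt : (o : ℕ) → o < n → Σ (Fin n) λ w → AtOffset w o
  pointAt o on with base + o <? n
  ... | yes p = fromℕ< p , inj₁ (sym (toℕ-fromℕ< p))
  ... | no np = fromℕ< q , inj₂ (sym (trans (cong (_+ n) (toℕ-fromℕ< q)) (m∸n+n≡m n≤)))
    where
    n≤ : n ≤ base + o
    n≤ = ≮⇒≥ np
    q : base + o ∸ n < n
    q = +-cancelʳ-< n (base + o ∸ n) n (subst (_< n + n) (sym (m∸n+n≡m n≤)) (+-mono-< (toℕ<n s₀) on))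

  order-unwrapped : ∀ (u v : Fin n) ou ov → base + ou ≡ toℕ u → base + ov ≡ toℕ v → ou < ov → toℕ u < toℕ v
  order-unwrapped u v ou ov e e' lt = subst₂ _<_ e e' (+-monoʳ-< base lt)

  order-wrapped : ∀ (u v : Fin n) ou ov → base + ou ≡ toℕ u + n → base + ov ≡ toℕ v + n → ou < ov → toℕ u < toℕ v
  order-wrapped u v ou ov e e' lt = +-cancelʳ-< n (toℕ u) (toℕ v) (subst₂ _<_ e e' (+-monoʳ-< base lt))

  order-mixed : ∀ (u v : Fin n) ou ov → base + ou ≡ toℕ u → base + ov ≡ toℕ v + n → ov < n → toℕ v < toℕ u
  order-mixed u v ou ov e e' ovn =
    <-≤-trans (+-cancelʳ-< n (toℕ v) base (subst (_< base + n) e' (+-monoʳ-< base ovn))) (subst (base ≤_) e (m≤m+n base ou))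

  wrap-stays : ∀ (u v : Fin n) ou ov → base + ou ≡ toℕ u + n → base + ov ≡ toℕ v → ou < ov → ⊥
  wrap-stays u v ou ov e e' lt =
    <-irrefl refl (<-≤-trans (<-trans (subst₂ _<_ e e' (+-monoʳ-< base lt)) (toℕ<n v)) (m≤n+m n (toℕ u)))

  offsets-noCrossing : (y : Part n) → IsNonCrossing y → (e₁ e₂ e₃ e₄ : Fin n) (o₁ o₂ o₃ o₄ : ℕ) →
    AtOffset e₁ o₁ → AtOffset e₂ o₂ → AtOffset e₃ o₃ → AtOffset e₄ o₄ → o₁ < o₂ → o₂ < o₃ → o₃ < o₄ → o₄ < n →
    SameBlock y e₁ e₃ → SameBlock y e₂ e₄ → ¬ SameBlock y e₁ e₂ → ⊥
  offsets-noCrossing y nc e₁ e₂ e₃ e₄ o₁ o₂ o₃ o₄ f₁ f₂ f₃ f₄ l₁₂ l₂₃ l₃₄ l₄ s₁₃ s₂₄ n₁₂ = go f₁ f₂ f₃ f₄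
    where
    go : AtOffset e₁ o₁ → AtOffset e₂ o₂ → AtOffset e₃ o₃ → AtOffset e₄ o₄ → ⊥
    go (inj₁ a) (inj₁ b) (inj₁ c) (inj₁ d) = n₁₂ (nc e₁ e₂ e₃ e₄
      (order-unwrapped _ _ _ _ a b l₁₂) (order-unwrapped _ _ _ _ b c l₂₃) (order-unwrapped _ _ _ _ c d l₃₄) s₁₃ s₂₄)
    go (inj₂ a) (inj₂ b) (inj₂ c) (inj₂ d) = n₁₂ (nc e₁ e₂ e₃ e₄
      (order-wrapped _ _ _ _ a b l₁₂) (order-wrapped _ _ _ _ b c l₂₃) (order-wrapped _ _ _ _ c d l₃₄) s₁₃ s₂₄)
    go (inj₁ a) (inj₁ b) (inj₁ c) (inj₂ d) = n₁₂ (trans (sym (nc e₄ e₁ e₂ e₃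
      (order-mixed _ _ _ _ a d l₄) (order-unwrapped _ _ _ _ a b l₁₂) (order-unwrapped _ _ _ _ b c l₂₃) (sym s₂₄) s₁₃)) (sym s₂₄))
    go (inj₁ a) (inj₁ b) (inj₂ c) (inj₂ d) = n₁₂ (trans s₁₃ (trans (nc e₃ e₄ e₁ e₂
      (order-wrapped _ _ _ _ c d l₃₄) (order-mixed _ _ _ _ a d l₄) (order-unwrapped _ _ _ _ a b l₁₂) (sym s₁₃) (sym s₂₄)) (sym s₂₄)))
    go (inj₁ a) (inj₂ b) (inj₂ c) (inj₂ d) = n₁₂ (trans s₁₃ (sym (nc e₂ e₃ e₄ e₁
      (order-wrapped _ _ _ _ b c l₂₃) (order-wrapped _ _ _ _ c d l₃₄) (order-mixed _ _ _ _ a d l₄) s₂₄ (sym s₁₃))))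
    go (inj₂ a) (inj₁ b) _ _ = wrap-stays _ _ _ _ a b l₁₂
    go (inj₂ a) (inj₂ b) (inj₁ c) _ = wrap-stays _ _ _ _ b c l₂₃
    go (inj₂ a) (inj₂ b) (inj₂ c) (inj₁ d) = wrap-stays _ _ _ _ c d l₃₄
    go (inj₁ a) (inj₂ b) (inj₁ c) _ = wrap-stays _ _ _ _ b c l₂₃
    go (inj₁ a) (inj₂ b) (inj₂ c) (inj₁ d) = wrap-stays _ _ _ _ c d l₃₄
    go (inj₁ a) (inj₁ b) (inj₂ c) (inj₁ d) = wrap-stays _ _ _ _ c d l₃₄

-- Deleting a point a from an arc A leaves an arc P = A ∖ {a} when a is the
-- first or the last point of A (the first case needs a second point, 1 < n).
module ArcEnds {n : ℕ} (s₀ : Fin n) (l₀ : ℕ) (l₀≤n : l₀ ≤ n) (P : Fin n → Set) (a : Fin n)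
  (covers : ∀ w → InArc s₀ l₀ w → P w ⊎ w ≡ a) (inside : ∀ w → P w → InArc s₀ l₀ w)
  (a-in : InArc s₀ l₀ a) (a-out : ¬ P a) where
  open Offsets s₀

  oa = offset a

  oa<l₀ : oa < l₀
  oa<l₀ = inArc⇒offset< l₀ a oa l₀≤n (offset<n a) (at-offset a) a-in

  offset-P : ∀ w → P w → offset w < l₀
  offset-P w q = inArc⇒offset< l₀ w (offset w) l₀≤n (offset<n w) (at-offset w) (inside w q)

  offset-P≢oa : ∀ w → P w → offset w ≢ oa
  offset-P≢oa w q e = a-out (subst P (offset-injective w a oa (subst (AtOffset w) e (at-offset w)) (at-offset a)) q)

  inP : ∀ w o → AtOffset w o → o < l₀ → o ≢ oa → P w
  inP w o f ol ne = [ (λ q → q) , (λ { refl → ⊥-elim (ne (offset-unique a o oa (<-≤-trans ol l₀≤n) (offset<n a) f (at-offset a))) }) ]′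
    (covers w (offset<⇒inArc l₀ w o f ol))

  lastPoint : suc oa ≡ l₀ → IsArc P
  lastPoint e = s₀ , oa , oa≤n , λ w → to w , from w
    where
    oa≤n : oa ≤ n
    oa≤n = <⇒≤ (<-≤-trans oa<l₀ l₀≤n)
    to : ∀ w → P w → InArc s₀ oa w
    to w q = offset<⇒inArc oa w (offset w) (at-offset w)
      (≤∧≢⇒< (s≤s⁻¹ (subst (suc (offset w) ≤_) (sym e) (offset-P w q))) (offset-P≢oa w q))
    from : ∀ w → InArc s₀ oa w → P w
    from w iw = inP w (offset w) (at-offset w) (<-trans below oa<l₀) (λ q → <-irrefl q below)
      where
      below : offset w < oa
      below = inArc⇒offset< oa w (offset w) oa≤n (offset<n w) (at-offset w) iw

  module AfterBase (1<n : 1 < n) where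
    -- the point s₁ following s₀; offsets measured from s₁ are one smaller
    s₁ = proj₁ (pointAt 1 1<n)
    module O₁ = Offsets s₁

    private
      base₁ = toℕ s₁
      shift : ∀ o → base + suc o ≡ (base + 1) + o
      shift o = sym (+-assoc base 1 o)
      wrap : ∀ o → (base₁ + n) + o ≡ (base₁ + o) + n
      wrap o = trans (+-assoc base₁ n o) (trans (cong (base₁ +_) (+-comm n o)) (sym (+-assoc base₁ o n)))

    offset-down : ∀ w o → AtOffset w (suc o) → O₁.AtOffset w o
    offset-down w o f with proj₂ (pointAt 1 1<n) | f
    ... | inj₁ e | inj₁ q = inj₁ (trans (cong (_+ o) (sym e)) (trans (sym (shift o)) q))
    ... | inj₁ e | inj₂ q = inj₂ (trans (cong (_+ o) (sym e)) (trans (sym (shift o)) q))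
    ... | inj₂ e | inj₁ q = ⊥-elim (<-irrefl refl (<-≤-trans (toℕ<n w)
          (subst (n ≤_) (trans (sym (wrap o)) (trans (cong (_+ o) (sym e)) (trans (sym (shift o)) q))) (m≤n+m n _))))
    ... | inj₂ e | inj₂ q = inj₁ (+-cancelʳ-≡ n _ _ (trans (sym (wrap o)) (trans (cong (_+ o) (sym e)) (trans (sym (shift o)) q))))

    offset-up : ∀ w o → suc o < n → O₁.AtOffset w o → AtOffset w (suc o)
    offset-up w o on f with proj₂ (pointAt 1 1<n) | f
    ... | inj₁ e | inj₁ q = inj₁ (trans (shift o) (trans (cong (_+ o) e) q))
    ... | inj₁ e | inj₂ q = inj₂ (trans (shift o) (trans (cong (_+ o) e) q))
    ... | inj₂ e | inj₁ q = inj₂ (trans (shift o) (trans (cong (_+ o) e) (trans (wrap o) (cong (_+ n) q))))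
    ... | inj₂ e | inj₂ q = ⊥-elim (<-irrefl refl (<-≤-trans twiceWrapped (+-monoˡ-≤ n (m≤n+m n (toℕ w)))))
      where
      twiceWrapped : toℕ w + n + n < n + n
      twiceWrapped = subst (_< n + n) (trans (shift o) (trans (cong (_+ o) e) (trans (wrap o) (cong (_+ n) q))))
        (+-mono-< (toℕ<n s₀) on)

    firstPoint : oa ≡ 0 → IsArc P
    firstPoint e = s₁ , pred l₀ , ≤-trans pred[n]≤n l₀≤n , λ w → to w , from w
      where
      to : ∀ w → P w → InArc s₁ (pred l₀) w
      to w q with offset w in eq
      ... | zero = ⊥-elim (offset-P≢oa w q (trans eq (sym e)))
      ... | suc o = O₁.offset<⇒inArc (pred l₀) w o (offset-down w o (subst (AtOffset w) eq (at-offset w)))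
                      (suc[m]≤n⇒m≤pred[n] (subst (_< l₀) eq (offset-P w q)))
      from : ∀ w → InArc s₁ (pred l₀) w → P w
      from w iw = inP w (suc o₁) (offset-up w o₁ (<-≤-trans sl l₀≤n) (O₁.at-offset w)) sl (λ q → 0≢suc (trans (sym e) (sym q)))
        where
        o₁ = O₁.offset w
        sl : suc o₁ < l₀
        sl = ≤-trans (s≤s (O₁.inArc⇒offset< (pred l₀) w o₁ (≤-trans pred[n]≤n l₀≤n) (O₁.offset<n w) (O₁.at-offset w) iw))
          (≤-reflexive (suc-pred l₀ {{>-nonZero (≤-<-trans z≤n oa<l₀)}}))
        0≢suc : ∀ {k} → 0 ≢ suc k
        0≢suc ()

-- If a lies strictly inside A, then for any non-crossing y' keeping P in one
-- block and joining a to a point b outside A, the first and last points of A,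
-- a, and b form a crossing of y'.  So in presence of such y', A ∖ {a} is an arc.
module ArcMinusPoint {n : ℕ} (s₀ : Fin n) (l₀ : ℕ) (l₀≤n : l₀ ≤ n) (P : Fin n → Set) (a b p₀ : Fin n)
  (covers : ∀ w → InArc s₀ l₀ w → P w ⊎ w ≡ a) (inside : ∀ w → P w → InArc s₀ l₀ w)
  (a-in : InArc s₀ l₀ a) (b-out : ¬ InArc s₀ l₀ b)
  (y' : Part n) (y'-nc : IsNonCrossing y') (P-together : ∀ w → P w → y' ! w ≡ y' ! p₀)
  (ab-together : y' ! a ≡ y' ! b) (a-apart : y' ! a ≢ y' ! p₀) where
  open Offsets s₀
  open ArcEnds s₀ l₀ l₀≤n P a covers inside a-in (λ q → a-apart (P-together a q))

  innerPoint : ∀ k → oa ≡ suc k → suc oa < l₀ → ⊥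
  innerPoint k e sl = offsets-noCrossing y' y'-nc p a r b 0 oa (pred l₀) ob fp (at-offset a) fr (at-offset b)
    0<oa oa<last last<ob (offset<n b) (trans (P-together p pP) (sym (P-together r rP))) ab-together
    (λ q → a-apart (trans (sym q) (P-together p pP)))
    where
    0<l₀ : 0 < l₀
    0<l₀ = ≤-<-trans z≤n oa<l₀
    last<l₀ : pred l₀ < l₀
    last<l₀ = ≤-reflexive (suc-pred l₀ {{>-nonZero 0<l₀}})
    last<n : pred l₀ < n
    last<n = <-≤-trans last<l₀ l₀≤n
    p = proj₁ (pointAt 0 (≤-<-trans z≤n last<n))
    fp = proj₂ (pointAt 0 (≤-<-trans z≤n last<n))
    r = proj₁ (pointAt (pred l₀) last<n)
    fr = proj₂ (pointAt (pred l₀) last<n)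
    ob = offset b
    0<oa : 0 < oa
    0<oa = subst (0 <_) (sym e) (s≤s z≤n)
    oa<last : oa < pred l₀
    oa<last = suc[m]≤n⇒m≤pred[n] sl
    last<ob : pred l₀ < ob
    last<ob = <-≤-trans last<l₀ (≮⇒≥ (λ q → b-out (offset<⇒inArc l₀ b ob (at-offset b) q)))
    pP : P p
    pP = inP p 0 fp 0<l₀ (λ q → <-irrefl q 0<oa)
    rP : P r
    rP = inP r (pred l₀) fr last<l₀ (λ q → <-irrefl (sym q) oa<last)

  a≢b : a ≢ b
  a≢b refl = b-out a-in

  1<n : 1 < n
  1<n with <-cmp (toℕ a) (toℕ b)
  ... | tri< lt _ _ = ≤-<-trans (≤-<-trans z≤n lt) (toℕ<n b)
  ... | tri≈ _ eq _ = ⊥-elim (a≢b (toℕ-injective eq))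
  ... | tri> _ _ gt = ≤-<-trans (≤-<-trans z≤n gt) (toℕ<n a)
  open AfterBase 1<n

  arc : IsArc P
  arc with suc oa ≟ℕ l₀
  ... | yes e = lastPoint e
  ... | no ne with oa in eq
  ... | zero = firstPoint eq
  ... | suc k = ⊥-elim (innerPoint k eq (≤∧≢⇒< oa<l₀ (λ q → ne (subst (λ v → suc v ≡ l₀) eq q))))

OneBlock : {n : ℕ} → Part n → Fin n → Set
OneBlock {n} v c = ∀ i → v ! i ≡ i ⊎ v ! i ≡ c

-- How a middle partition y of a rank-two interval x ≤ z acts on the
-- representatives of x: it performs the merge of its pattern and nothing else.
module OnRepresentatives {n : ℕ} (x z : Part n) (px : IsPartition x) (pz : IsPartition z) (rxz : Refines x z)
  (I : LostPair x z) where
  open LostPair I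

  repKind : ∀ u → x ! u ≡ u → z ! u ≡ u ⊎ u ≡ r₁ ⊎ u ≡ r₂
  repKind u e with z ! u ≟ u
  ... | yes q = inj₁ q
  ... | no q = inj₂ (lost-only u e q)

  moved-rep : ∀ t → x ! moved t ≡ moved t
  moved-rep t = [ (λ e → subst (λ w → x ! w ≡ w) (sym e) x-r₁) , (λ e → subst (λ w → x ! w ≡ w) (sym e) x-r₂) ]′
    (moved-lost t)

  moved-notZRep : ∀ t → z ! moved t ≢ moved t
  moved-notZRep t = [ (λ e → subst (λ w → z ! w ≢ w) (sym e) z-r₁) , (λ e → subst (λ w → z ! w ≢ w) (sym e) z-r₂) ]′
    (moved-lost t)

  merged-reps : ∀ t {u v} → Merged t u v → x ! u ≡ u × x ! v ≡ v
  merged-reps t (inj₁ (refl , refl)) = moved-rep t , target-rep x z px pz rxz I t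
  merged-reps t (inj₂ (refl , refl)) = target-rep x z px pz rxz I t , moved-rep t

  merged-distinct : ∀ t {u v} → Merged t u v → u ≢ v
  merged-distinct t (inj₁ (refl , refl)) e = target≢moved t (sym e)
  merged-distinct t (inj₂ (refl , refl)) e = target≢moved t e

  merged-sym : ∀ t {u v} → Merged t u v → Merged t v u
  merged-sym t (inj₁ (p , q)) = inj₂ (q , p)
  merged-sym t (inj₂ (p , q)) = inj₁ (q , p)

  merged-functional : ∀ t {a b c} → Merged t a b → Merged t a c → b ≡ c
  merged-functional t (inj₁ (refl , refl)) (inj₁ (_ , refl)) = refl
  merged-functional t (inj₁ (refl , refl)) (inj₂ (e , _)) = ⊥-elim (target≢moved t (sym e))
  merged-functional t (inj₂ (refl , refl)) (inj₁ (e , _)) = ⊥-elim (target≢moved t e)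
  merged-functional t (inj₂ (refl , refl)) (inj₂ (_ , refl)) = refl

  record Between (y : Part n) : Set where
    field
      y-part : IsPartition y
      x≤y : Refines x y
      y≤z : Refines y z
      tag : Tag
      y-pattern : Pattern x z I tag y

  middleBetween : ∀ {k y} t → Middle x z k y → Pattern x z I t y → Between y
  middleBetween t ((py , _) , _ , rxy , ryz) p = record { y-part = py ; x≤y = rxy ; y≤z = ryz ; tag = t ; y-pattern = p }

  module _ {y : Part n} (B : Between y) where
    open Between B

    y-moved : y ! moved tag ≡ target tag
    y-moved = go tag y-pattern
      where
      go : ∀ t → Pattern x z I t y → y ! moved t ≡ target t
      go joins₂ (_ , b) = b
      go joins₁ (a , _) = a
      go joins₁₂ (_ , b) = b

    y-kept : ∀ u → x ! u ≡ u → u ≢ moved tag → y ! u ≡ u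
    y-kept u xu ne with repKind u xu
    ... | inj₁ zu = rep-of-coarser y z y-part pz y≤z u zu
    ... | inj₂ (inj₁ refl) = kept₁ tag y-pattern ne
      where
      kept₁ : ∀ t → Pattern x z I t y → r₁ ≢ moved t → y ! r₁ ≡ r₁
      kept₁ joins₂ (a , _) _ = a
      kept₁ joins₁ _ ne = ⊥-elim (ne refl)
      kept₁ joins₁₂ (a , _) _ = a
    ... | inj₂ (inj₂ refl) = kept₂ tag y-pattern ne
      where
      kept₂ : ∀ t → Pattern x z I t y → r₂ ≢ moved t → y ! r₂ ≡ r₂
      kept₂ joins₂ _ ne = ⊥-elim (ne refl)
      kept₂ joins₁ (_ , b) _ = b
      kept₂ joins₁₂ _ ne = ⊥-elim (ne refl)

    y-target : y ! target tag ≡ target tag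
    y-target = y-kept (target tag) (target-rep x z px pz rxz I tag) (target≢moved tag)

    y-merged : ∀ {u v} → Merged tag u v → y ! u ≡ y ! v
    y-merged (inj₁ (refl , refl)) = trans y-moved (sym y-target)
    y-merged (inj₂ (refl , refl)) = trans y-target (sym y-moved)

    joined : ∀ u v → x ! u ≡ u → x ! v ≡ v → y ! u ≡ y ! v → u ≡ v ⊎ Merged tag u v
    joined u v xu xv e with u ≟ moved tag | v ≟ moved tag
    ... | yes eu | yes ev = inj₁ (trans eu (sym ev))
    ... | yes eu | no nv = inj₂ (inj₁ (eu , trans (sym (y-kept v xv nv)) (trans (sym e) (trans (cong (y !_) eu) y-moved))))
    ... | no nu | yes ev = inj₂ (inj₂ (trans (sym (y-kept u xu nu)) (trans e (trans (cong (y !_) ev) y-moved)) , ev))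
    ... | no nu | no nv = inj₁ (trans (sym (y-kept u xu nu)) (trans e (y-kept v xv nv)))

    arc-unchanged : ∀ c → x ! c ≡ c → (∀ a → ¬ Merged tag c a) → CircConsecBlockAt y c → CircConsecBlockAt x c
    arc-unchanged c xc unmerged (s₀ , l₀ , l₀≤n , arcY) =
      s₀ , l₀ , l₀≤n , λ w → (λ q → proj₁ (arcY w) (x≤y c w q)) , (λ q → back w (proj₂ (arcY w) q))
      where
      back : ∀ w → SameBlock y c w → SameBlock x c w
      back w e with joined (x ! w) c (rep-idem x px w) xc (sym (trans e (refines-rep x y px x≤y w)))
      ... | inj₁ q = trans xc (sym q)
      ... | inj₂ m = ⊥-elim (unmerged (x ! w) (merged-sym tag m))

  arc-minusPoint : ∀ {y y'} (B : Between y) (B' : Between y') → IsNonCrossing y' →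
    ∀ c a b → OneBlock x c → x ! c ≡ c → Merged (Between.tag B) c a → Merged (Between.tag B') a b → b ≢ c →
    CircConsecBlockAt y c → CircConsecBlockAt x c
  arc-minusPoint {y} {y'} B B' nc' c a b ix xc m m' b≢c (s₀ , l₀ , l₀≤n , arcY) =
    ArcMinusPoint.arc s₀ l₀ l₀≤n (SameBlock x c) a b c covers inside a-in b-out y' nc'
      (λ w q → sym (Between.x≤y B' c w q)) (y-merged B' m') a-apart
    where
    t = Between.tag B
    t' = Between.tag B'
    a≢c : a ≢ c
    a≢c e = merged-distinct t m (sym e)
    xb = proj₂ (merged-reps t' m')
    covers : ∀ w → InArc s₀ l₀ w → SameBlock x c w ⊎ w ≡ a
    covers w iw with joined B (x ! w) c (rep-idem x px w) xc (sym (trans (proj₂ (arcY w) iw) (refines-rep x y px (Between.x≤y B) w)))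
    ... | inj₁ e = inj₁ (trans xc (sym e))
    ... | inj₂ mw with ix w
    ... | inj₁ q = inj₂ (trans (sym q) (merged-functional t (merged-sym t mw) m))
    ... | inj₂ q = ⊥-elim (a≢c (trans (sym (merged-functional t (merged-sym t mw) m)) q))
    inside : ∀ w → SameBlock x c w → InArc s₀ l₀ w
    inside w q = proj₁ (arcY w) (Between.x≤y B c w q)
    a-in : InArc s₀ l₀ a
    a-in = proj₁ (arcY a) (y-merged B m)
    b-out : ¬ InArc s₀ l₀ b
    b-out q with joined B b c xb xc (sym (proj₂ (arcY b) q))
    ... | inj₁ e = b≢c e
    ... | inj₂ mb = merged-distinct t' m' (merged-functional t m (merged-sym t mb))
    a-apart : y' ! a ≢ y' ! c
    a-apart e with joined B' a c (proj₁ (merged-reps t' m')) xc e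
    ... | inj₁ q = a≢c q
    ... | inj₂ ma = b≢c (merged-functional t' m' ma)

  oneBlock-base : ∀ {y} (B : Between y) → (∀ i → x ! i ≡ i) → OneBlock y (target (Between.tag B))
  oneBlock-base B allReps i with i ≟ moved (Between.tag B)
  ... | yes refl = inj₂ (y-moved B)
  ... | no ne = inj₁ (y-kept B i (allReps i) ne)

  -- When both lost representatives lie in the same z-block (represented by s),
  -- the three merges join two of the three x-representatives r₁, r₂, s.
  module SameZBlock (r₁~r₂ : z ! r₁ ≡ z ! r₂) where
    s : Fin n
    s = z ! r₁

    s≢r₁ : s ≢ r₁
    s≢r₁ = z-r₁

    s≢r₂ : s ≢ r₂
    s≢r₂ e = z-r₂ (trans (sym r₁~r₂) e)

    zRep-target : ∀ t → z ! target t ≡ target t → target t ≡ s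
    zRep-target joins₂ _ = sym r₁~r₂
    zRep-target joins₁ _ = refl
    zRep-target joins₁₂ zr = ⊥-elim (z-r₁ zr)

    oneBlock-step : ∀ {y} (B : Between y) c → OneBlock y c → OneBlock z s
    oneBlock-step {y} B c iy i with repKind (x ! i) (rep-idem x px i)
    ... | inj₂ (inj₁ e) = inj₂ (trans (refines-rep x z px rxz i) (cong (z !_) e))
    ... | inj₂ (inj₂ e) = inj₂ (trans (refines-rep x z px rxz i) (trans (cong (z !_) e) (sym r₁~r₂)))
    ... | inj₁ zw = [ (λ e → inj₁ (trans zi (trans (sym yi) e))) , (λ e → inj₂ (trans zi (trans (sym yi) (trans e (c≡s e))))) ]′ (iy i)
      where
      open Between B using (tag)
      w = x ! i
      zi : z ! i ≡ w
      zi = trans (refines-rep x z px rxz i) zw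
      yi : y ! i ≡ w
      yi = trans (refines-rep x y px (Between.x≤y B) i) (y-kept B w (rep-idem x px i) (λ e → moved-notZRep tag (subst (λ v → z ! v ≡ v) e zw)))
      c≡target : c ≡ target tag
      c≡target = [ (λ e → ⊥-elim (target≢moved tag (trans (sym (y-moved B)) e))) , (λ e → trans (sym e) (y-moved B)) ]′
        (iy (moved tag))
      c≡s : y ! i ≡ c → c ≡ s
      c≡s e = trans c≡target (zRep-target tag (subst (λ v → z ! v ≡ v) (trans (sym yi) (trans e c≡target)) zw))

    otherMerge : ∀ t c a → Merged t c a → Σ Tag λ t' → Σ (Fin n) λ b → Merged t' a b × b ≢ c
    otherMerge joins₂ c a (inj₁ (refl , refl)) = joins₁ , r₁ , inj₂ (sym r₁~r₂ , refl) , r₁≢r₂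
    otherMerge joins₂ c a (inj₂ (refl , refl)) = joins₁₂ , r₁ , inj₁ (refl , refl) , λ e → s≢r₁ (trans r₁~r₂ (sym e))
    otherMerge joins₁ c a (inj₁ (refl , refl)) = joins₂ , r₂ , inj₂ (r₁~r₂ , refl) , ≢-sym r₁≢r₂
    otherMerge joins₁ c a (inj₂ (refl , refl)) = joins₁₂ , r₂ , inj₂ (refl , refl) , ≢-sym s≢r₂
    otherMerge joins₁₂ c a (inj₁ (refl , refl)) = joins₁ , s , inj₁ (refl , refl) , s≢r₂
    otherMerge joins₁₂ c a (inj₂ (refl , refl)) = joins₂ , z ! r₂ , inj₁ (refl , refl) , λ e → s≢r₁ (trans r₁~r₂ e)

    arc-otherMerge : ∀ {k y} (B : Between y) → AllPatterns x z k I → ∀ c a → OneBlock x c → x ! c ≡ c →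
      Merged (Between.tag B) c a → CircConsecBlockAt y c → CircConsecBlockAt x c
    arc-otherMerge B R c a ix xc m arcY with otherMerge (Between.tag B) c a m
    ... | t' , b , m' , b≢c = arc-minusPoint B (middleBetween t' (witness-middle t') (witness-pattern t'))
      (proj₂ (proj₁ (witness-middle t'))) c a b ix xc m m' b≢c arcY
      where open AllPatterns R

    arc-descent : ∀ {k y} (B : Between y) → AllPatterns x z k I → ∀ c → OneBlock x c → x ! c ≡ c →
      CircConsecBlockAt y c → CircConsecBlockAt x c
    arc-descent B R c ix xc arcY with c ≟ moved (Between.tag B) | c ≟ target (Between.tag B)
    ... | yes e | _ = arc-otherMerge B R c _ ix xc (inj₁ (e , refl)) arcY
    ... | no _ | yes e = arc-otherMerge B R c _ ix xc (inj₂ (e , refl)) arcY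
    ... | no n₁ | no n₂ = arc-unchanged B c xc (λ a → [ (λ m → n₁ (proj₁ m)) , (λ m → n₂ (proj₁ m)) ]′) arcY

IsArc-cong : {n : ℕ} {P Q : Fin n → Set} → (∀ w → P w → Q w) → (∀ w → Q w → P w) → IsArc P → IsArc Q
IsArc-cong to from (s , l , l≤n , h) = s , l , l≤n , λ w → (λ q → proj₁ (h w) (from w q)) , (λ i → to w (proj₂ (h w) i))

module _ {n : ℕ} where
  -- the complement of a point is an arc: remove the first point e of the whole circle from e
  coPoint-arc : (e : Fin n) → 1 < n → IsArc (λ w → w ≢ e)
  coPoint-arc e 1<n = AfterBase.firstPoint 1<n offset-e
    where
    open Offsets e
    whole : ∀ w → InArc e n w
    whole w = offset<⇒inArc n w (offset w) (at-offset w) (offset<n w)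
    covers : ∀ w → InArc e n w → w ≢ e ⊎ w ≡ e
    covers w _ with w ≟ e
    ... | yes q = inj₂ q
    ... | no q = inj₁ q
    open ArcEnds e n ≤-refl (λ w → w ≢ e) e covers (λ w _ → whole w) (whole e) (λ ne → ne refl)
    offset-e : offset e ≡ 0
    offset-e = offset-unique e (offset e) 0 (offset<n e) (≤-<-trans z≤n (toℕ<n e)) (at-offset e)
      (inj₁ (+-identityʳ (toℕ e)))

  nonRep : (v : Part n) (j : ℕ) → rank v ≡ suc j → Σ (Fin n) λ i → v ! i ≢ i
  nonRep v j rk = ¬∀⟶∃¬ n (λ i → v ! i ≡ i) (λ i → v ! i ≟ i) notAllReps
    where
    notAllReps : ¬ (∀ i → v ! i ≡ i)
    notAllReps allReps = 0≢suc (trans (sym rank≡0) rk)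
      where
      rank≡0 : rank v ≡ 0
      rank≡0 = trans (cong (n ∸_) (trans (numBlocks≡reps v) (sumFin-ones (isRep v) (λ i → isRep-yes v i (allReps i)))))
        (n∸n≡0 n)
      0≢suc : ∀ {a} → 0 ≢ suc a
      0≢suc ()

  oneBlock-rep : (v : Part n) (c i₀ : Fin n) → IsPartition v → OneBlock v c → v ! i₀ ≢ i₀ → v ! c ≡ c
  oneBlock-rep v c i₀ pv iv ne with iv i₀
  ... | inj₁ e = ⊥-elim (ne e)
  ... | inj₂ e = subst (λ w → v ! w ≡ w) e (rep-idem v pv i₀)

  oneBlock-arcs : (v : Part n) (c : Fin n) → OneBlock v c → v ! c ≡ c → CircConsecBlockAt v c →
    ∀ i → CircConsecBlockAt v i
  oneBlock-arcs v c iv vc arcC i with v ! i ≟ c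
  ... | yes e = arc-transport v c i (trans vc (sym e)) arcC
  ... | no ne = singleton-arc v i alone
    where
    vi : v ! i ≡ i
    vi = [ (λ q → q) , (λ q → ⊥-elim (ne q)) ]′ (iv i)
    alone : ∀ w → SameBlock v i w → w ≡ i
    alone w e = [ (λ q → trans (sym q) (trans (sym e) vi)) , (λ q → ⊥-elim (ne (trans e q))) ]′ (iv w)

  oneBlock-universal : (v : Part n) (c i₀ : Fin n) → OneBlock v c → v ! c ≡ c → v ! i₀ ≢ i₀ →
    CircConsecBlockAt v c → IsUniversal v
  oneBlock-universal v c i₀ iv vc ne arcC = c , (i₀ , i₀≢c , trans vc (sym vi₀)) , single , arcC
    where
    vi₀ : v ! i₀ ≡ c
    vi₀ = [ (λ q → ⊥-elim (ne q)) , (λ q → q) ]′ (iv i₀)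
    i₀≢c : i₀ ≢ c
    i₀≢c e = ne (trans vi₀ (sym e))
    toC : ∀ j → NonTrivialBlockAt v j → v ! j ≡ c
    toC j (w , w≢j , e) with iv j | iv w
    ... | inj₂ q | _ = q
    ... | inj₁ q | inj₁ q' = ⊥-elim (w≢j (trans (sym q') (trans (sym e) q)))
    ... | inj₁ q | inj₂ q' = trans e q'
    single : ∀ j l → NonTrivialBlockAt v j → NonTrivialBlockAt v l → SameBlock v j l
    single j l a b = trans (toC j a) (sym (toC l b))

  -- with two blocks, one of them represented by c, the block of c is an arc:
  -- it is the complement of the other representative
  twoBlocks-arc : (v : Part n) (c : Fin n) → 1 < n → OneBlock v c → v ! c ≡ c → sumFin (isRep v) ≡ 2 →
    CircConsecBlockAt v c
  twoBlocks-arc v c 1<n iv vc twoReps = IsArc-cong to from (coPoint-arc e 1<n)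
    where
    others = dropAt c (isRep v)
    oneOther : sumFin others ≡ 1
    oneOther = +-cancelˡ-≡ 1 _ _ (trans (cong (_+ sumFin others) (sym (isRep-yes v c vc)))
      (trans (sym (sumFin-dropAt c (isRep v))) twoReps))
    other = singleSupport others (dropAt-≤1 c (isRep v) (λ i → indicator≤1 (v ! i ≟ i))) oneOther
    e = proj₁ other
    e≢c : e ≢ c
    e≢c q = <-irrefl (sym (trans (cong others q) (dropAt-≡ c (isRep v)))) (proj₁ (proj₂ other))
    ve : v ! e ≡ e
    ve = isRep-pos v e (subst (0 <_) (dropAt-≢ c (isRep v) e e≢c) (proj₁ (proj₂ other)))
    onlyOther : ∀ w → v ! w ≡ w → w ≢ c → w ≡ e
    onlyOther w q nc = proj₂ (proj₂ other) w
      (subst (0 <_) (sym (dropAt-≢ c (isRep v) w nc)) (subst (0 <_) (sym (isRep-yes v w q)) (s≤s z≤n)))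
    to : ∀ w → w ≢ e → SameBlock v c w
    to w ne with iv w
    ... | inj₂ q = trans vc (sym q)
    ... | inj₁ q with w ≟ c
    ... | yes refl = refl
    ... | no nc = ⊥-elim (ne (onlyOther w q nc))
    from : ∀ w → SameBlock v c w → w ≢ e
    from w q refl = e≢c (sym (trans (sym vc) (trans q ve)))

module ThreeChambersEverywhere (m : ℕ) (C : Vec (Part (Extended.N m)) (suc m)) (chC : IsChamber {Extended.N m} C)
  (H : (j : Fin (suc m)) → InExactlyThreeChambers {Extended.N m} C j) where
  open Extended m
  open ExtendedChamber C chC

  X : ℕ → Part N
  X = ext C

  module Interval (k : ℕ) (k≤m : k ≤ m) where
    x = X k
    y = X (suc k)
    z = X (suc (suc k))
    px = ext-part k
    pz = ext-part (suc (suc k))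
    rxz : Refines x z
    rxz = ext-refines k (suc (suc k)) (≤-trans (n≤1+n k) (n≤1+n _))
    rkz : rank z ≡ suc (suc k)
    rkz = ext-rank (suc (suc k)) (s≤s (s≤s k≤m))

    I : LostPair x z
    I = lostPair x z k px pz rxz (ext-rank k (≤-trans k≤m (≤-trans (n≤1+n m) (n≤1+n _)))) rkz

    open LostPair I
    open RankTwo x z px pz I k rkz
    open OnRepresentatives x z px pz rxz I public

    three : ThreeMiddles x z (suc k)
    three = subst (λ t → ThreeMiddles (X t) (X (suc (suc t))) (suc t)) (toℕ-fromℕ< (s≤s k≤m))
      (Face.threeChambers⇒threeMiddles C chC (fromℕ< (s≤s k≤m)) (H (fromℕ< (s≤s k≤m))))

    patterns : AllPatterns x z (suc k) I
    patterns = three⇒allPatterns three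

    y-middle : Middle x z (suc k) y
    y-middle = ext-ncp (suc k) , ext-rank (suc k) (s≤s (≤-trans k≤m (n≤1+n m))) ,
      ext-refines k (suc k) (n≤1+n k) , ext-refines (suc k) (suc (suc k)) (n≤1+n (suc k))

    y-between : Between y
    y-between = middleBetween (proj₁ (patternOf y y-middle)) y-middle (proj₂ (patternOf y y-middle))

    -- the merge of r₂ into r₁ is realised, so r₁ and r₂ lie in the same z-block
    r₁~r₂ : z ! r₁ ≡ z ! r₂
    r₁~r₂ = sym (trans (refines-rep w z (proj₁ (proj₁ w-middle)) (proj₂ (proj₂ (proj₂ w-middle))) r₂)
      (cong (z !_) (proj₂ (witness-pattern joins₁₂))))
      where
      open AllPatterns patterns
      w = witness joins₁₂
      w-middle = witness-middle joins₁₂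

    open SameZBlock r₁~r₂ public

  oneBlock-X : ∀ k → k ≤ m → Σ (Fin N) λ c → OneBlock (X (suc k)) c
  oneBlock-X zero le = _ , Interval.oneBlock-base zero le (Interval.y-between zero le) finest!
  oneBlock-X (suc k) le with oneBlock-X k (≤-trans (n≤1+n k) le)
  ... | c , ic = _ , Interval.oneBlock-step k k≤m (Interval.y-between k k≤m) c ic
    where
    k≤m = ≤-trans (n≤1+n k) le

  centre-X : ∀ k → k ≤ m → Σ (Fin N) λ c → Σ (Fin N) λ i₀ → OneBlock (X (suc k)) c × X (suc k) ! c ≡ c × X (suc k) ! i₀ ≢ i₀
  centre-X k le with oneBlock-X k le | nonRep (X (suc k)) k (ext-rank (suc k) (s≤s (≤-trans le (n≤1+n m))))
  ... | c , ic | i₀ , ne = c , i₀ , ic , oneBlock-rep (X (suc k)) c i₀ (ext-part (suc k)) ic ne , ne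

  arcs-X : ∀ d k → k + d ≡ m → ∀ i → CircConsecBlockAt (X (suc k)) i
  arcs-X zero k e with centre-X k (≤-reflexive (trans (sym (+-identityʳ k)) e))
  ... | c , _ , ic , xc , _ = oneBlock-arcs (X (suc k)) c ic xc
      (twoBlocks-arc (X (suc k)) c (s≤s (s≤s z≤n)) ic xc twoReps)
    where
    k≡m : k ≡ m
    k≡m = trans (sym (+-identityʳ k)) e
    twoReps : sumFin (isRep (X (suc k))) ≡ 2
    twoReps = +-cancelʳ-≡ (suc k) _ 2 (trans (reps+rank (X (suc k)) (suc k) (ext-rank (suc k) (s≤s (≤-trans (≤-reflexive k≡m) (n≤1+n m)))))
      (cong (λ t → suc (suc (suc t))) (sym k≡m)))
  arcs-X (suc d) k e with centre-X k (≤-trans (m≤m+n k (suc d)) (≤-reflexive e))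
  ... | c , _ , ic , xc , _ = oneBlock-arcs (X (suc k)) c ic xc
      (Interval.arc-descent (suc k) sk≤m (Interval.y-between (suc k) sk≤m) (Interval.patterns (suc k) sk≤m) c ic xc
        (arcs-X d (suc k) e' c))
    where
    e' : suc k + d ≡ m
    e' = trans (sym (+-suc k d)) e
    sk≤m : suc k ≤ m
    sk≤m = ≤-trans (m≤m+n (suc k) d) (≤-reflexive e')

  everyVertexUniversal : (kf : Fin (suc m)) → IsUniversal (lookup C kf)
  everyVertexUniversal kf with centre-X (toℕ kf) (s≤s⁻¹ (toℕ<n kf))
  ... | c , i₀ , ic , xc , ne = subst IsUniversal (ext-lookup C kf)
    (oneBlock-universal (X (suc (toℕ kf))) c i₀ ic xc ne (arcs-X (m ∸ toℕ kf) (toℕ kf) (m+[n∸m]≡n (s≤s⁻¹ (toℕ<n kf))) c))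

mainTheorem19 : (n : ℕ) → 3 ≤ n → (C : Chain n) → IsChamber C →
    (IsUniversalChamber C ⇔ ((j : Fin (n ∸ 2)) → InExactlyThreeChambers C j))
mainTheorem19 (suc (suc (suc m))) _ C chC =
  mk⇔ (UniversalChamber.everyFaceThree m C chC) (ThreeChambersEverywhere.everyVertexUniversal m C chC)
mainTheorem19 (suc zero) (s≤s ()) C chC
mainTheorem19 (suc (suc zero)) (s≤s (s≤s ())) C chC
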